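{- Let $\gamma>0$ and let $n\in\mathbb N$ be even with $1/n\ll\gamma$. Suppose that $G$ is a digraph on $n$ vertices such that for every $x\in V(G)$, $d^+(x)\ge (1/2-\gamma)n$ or $d^-(x)\ge(1/2-\gamma)n$. Then at least one of the following holds: $G$ contains a $6\gamma$-independent set of size at least $n/2$; $G$ is $6\gamma$-close to $2K_{n/2}$; $G$ contains a perfect matching.
   Context: $1/n\ll\gamma$ means $n$ is sufficiently large in terms of $\gamma$. A digraph has no loops and at most one edge in each direction between any two vertices; $d^\pm(x)$ are out-/indegree. For $G$ on $n$ vertices, $S\subseteq V(G)$ is $\beta$-independent if $G[S]$ has at most $\beta n^2$ (directed) edges. $G$ is $\beta$-close to $2K_{n/2}$ if there is a partition $A,B$ of $V(G)$ with $|A|=\lfloor n/2\rfloor$, $|B|=\lceil n/2\rceil$ and at most $\beta n^2$ edges of $G$ with one endpoint in $A$ and the other in $B$ (in either direction). A matching in a digraph is a set of vertex-disjoint (directed) edges; it is perfect if it covers all vertices.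
   Formalization: The parameter γ ranges over the positive rationals. -}

module Defs where

open import Data.Nat as ℕ using (ℕ; zero; suc; _+_; _*_)
open import Data.Nat.Divisibility using (_∣_)
open import Data.Integer using (+_)
open import Data.Rational as ℚ using (ℚ; _/_)
open import Data.Bool using (Bool; true; false; _∧_; _∨_; not; if_then_else_)
open import Data.Fin using (Fin)
open import Data.Fin.Subset using (Subset; _∈_; _∉_; ∣_∣)
open import Data.Fin.Subset.Properties using (_∈?_)
open import Data.Product using (_×_; _,_)
open import Data.List using (List; []; _∷_; concatMap)
open import Data.List.Relation.Unary.All using (All)
open import Data.List.Relation.Unary.Unique.Propositional using (Unique)
import Data.List.Membership.Propositional as LMem
open import Relation.Binary.PropositionalEquality using (_≡_)
open import Relation.Nullary.Decidable using (⌊_⌋)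

ℕ→ℚ : ℕ → ℚ
ℕ→ℚ m = + m / 1

sumFin : (n : ℕ) → (Fin n → ℕ) → ℕ
sumFin zero    f = 0
sumFin (suc n) f = f Fin.zero + sumFin n (λ i → f (Fin.suc i))
  where import Data.Fin as Fin

𝟙 : Bool → ℕ
𝟙 true  = 1
𝟙 false = 0

-- A digraph on vertex set Fin n: adjacency x → y is a boolean,
-- no loops; at most one edge in each direction is automatic.
record Digraph (n : ℕ) : Set where
  field
    adj      : Fin n → Fin n → Bool
    loopless : ∀ x → adj x x ≡ false
open Digraph public

outdeg : {n : ℕ} → Digraph n → Fin n → ℕ
outdeg {n} G x = sumFin n (λ y → 𝟙 (adj G x y))

indeg : {n : ℕ} → Digraph n → Fin n → ℕ
indeg {n} G x = sumFin n (λ y → 𝟙 (adj G y x))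

mem : {n : ℕ} → Fin n → Subset n → Bool
mem x S = ⌊ x ∈? S ⌋

edgesIn : {n : ℕ} → Digraph n → Subset n → ℕ
edgesIn {n} G S =
  sumFin n (λ x → sumFin n (λ y → 𝟙 (mem x S ∧ mem y S ∧ adj G x y)))

IsIndependent : {n : ℕ} → ℚ → Digraph n → Subset n → Set
IsIndependent {n} β G S = ℕ→ℚ (edgesIn G S) ℚ.≤ β ℚ.* ℕ→ℚ (n * n)

crossEdges : {n : ℕ} → Digraph n → Subset n → ℕ
crossEdges {n} G A =
  sumFin n (λ x → sumFin n (λ y →
    𝟙 (((mem x A ∧ not (mem y A)) ∨ (not (mem x A) ∧ mem y A)) ∧ adj G x y)))

complementSize : {n : ℕ} → Subset n → ℕ
complementSize {n} A = sumFin n (λ x → 𝟙 (not (mem x A)))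

record IsCloseTo2K {n : ℕ} (β : ℚ) (G : Digraph n) : Set where
  field
    A        : Subset n
    sizeA    : ∣ A ∣ ≡ n ℕ./ 2
    sizeB    : complementSize A ≡ (n + 1) ℕ./ 2
    fewCross : ℕ→ℚ (crossEdges G A) ℚ.≤ β ℚ.* ℕ→ℚ (n * n)

endpoints : {n : ℕ} → List (Fin n × Fin n) → List (Fin n)
endpoints = concatMap (λ { (x , y) → x ∷ y ∷ [] })

-- A perfect matching: a set (list) of directed edges of G that are
-- pairwise vertex-disjoint and cover every vertex, i.e. every vertex
-- occurs exactly once among the endpoints.
record PerfectMatching {n : ℕ} (G : Digraph n) : Set where
  field
    edges     : List (Fin n × Fin n)
    areEdges  : All (λ { (x , y) → adj G x y ≡ true }) edges
    disjoint  : Unique (endpoints edges)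
    covering  : ∀ (v : Fin n) → v LMem.∈ endpoints edges

module Submission where

-- Write γ = P/Q and let H be the
-- underlying undirected graph (x ~ y iff x → y or y → x); all H-degrees are
-- ≥ (1/2 - γ)n.  Run the augmenting-path algorithm on H, with matchings as
-- involutions σ: while an augmenting path with 1 or 3 edges, or with 5 edges
-- between two fixed unmatched u ≠ v, exists, fewer vertices stay unmatched.
-- A complete matching, oriented along G, is a perfect matching.  Otherwise
-- every matched vertex is a hub (sees u and v), a hub mate, a u-pair, a
-- v-pair or low, and the degrees of u and v leave few free or low vertices.
-- With a hub, the hub mates and free vertices form an edgeless set of size
-- ≥ h - 6γn; without one, no edge joins u-pairs and v-pairs, so a cut near
-- this split is sparse.

open import Defs
open import Data.Nat using (ℕ)


module FinSums where

  open import Data.Nat as N using (ℕ; zero; suc; _+_; _*_; _≤_; _<_; z≤n; s≤s)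
  open import Data.Nat.Properties
  open import Data.Bool using (Bool; true; false; not; _∧_)
  open import Data.Fin as F using (Fin)
  open import Data.Fin.Subset using (Subset; ∣_∣)
  open import Data.Fin.Subset.Properties using (_∈?_)
  open import Data.Fin.Permutation using (permutation)
  open import Data.Vec using ([]; _∷_)
  open import Data.Product using (Σ; _×_; _,_)
  open import Relation.Binary.PropositionalEquality
  open import Relation.Nullary.Decidable using (⌊_⌋)
  open import Relation.Nullary using (yes; no)
  open import Data.Empty using (⊥; ⊥-elim)
  open import Function using (_∘_)
  import Algebra.Properties.CommutativeMonoid.Sum as MonoidSum
  open import Data.Nat.Solver using (module +-*-Solver)
  open +-*-Solver

  sumFin-cong : ∀ n {f g : Fin n → ℕ} → (∀ x → f x ≡ g x) → sumFin n f ≡ sumFin n g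
  sumFin-cong zero e = refl
  sumFin-cong (suc n) e = cong₂ _+_ (e F.zero) (sumFin-cong n (e ∘ F.suc))

  sumFin-mono : ∀ n {f g : Fin n → ℕ} → (∀ x → f x ≤ g x) → sumFin n f ≤ sumFin n g
  sumFin-mono zero e = z≤n
  sumFin-mono (suc n) e = +-mono-≤ (e F.zero) (sumFin-mono n (e ∘ F.suc))

  sumFin-strict : ∀ n {f g : Fin n → ℕ} → (∀ x → f x ≤ g x) → (x₀ : Fin n) → f x₀ < g x₀ →
    sumFin n f < sumFin n g
  sumFin-strict (suc n) le F.zero lt = +-mono-<-≤ lt (sumFin-mono n (le ∘ F.suc))
  sumFin-strict (suc n) le (F.suc x) lt = +-mono-≤-< (le F.zero) (sumFin-strict n (le ∘ F.suc) x lt)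

  sumFin-pos : ∀ n (f : Fin n → ℕ) → 0 < sumFin n f → Σ (Fin n) λ x → 0 < f x
  sumFin-pos (suc n) f p with f F.zero in eq
  ... | suc k = F.zero , subst (0 <_) (sym eq) (s≤s z≤n)
  ... | zero with sumFin-pos n (f ∘ F.suc) p
  ... | x , q = F.suc x , q

  sumFin-+ : ∀ n (f g : Fin n → ℕ) → sumFin n (λ x → f x + g x) ≡ sumFin n f + sumFin n g
  sumFin-+ zero f g = refl
  sumFin-+ (suc n) f g rewrite sumFin-+ n (f ∘ F.suc) (g ∘ F.suc) =
    solve 4 (λ a b c d → (a :+ b) :+ (c :+ d) := (a :+ c) :+ (b :+ d)) refl
      (f F.zero) (g F.zero) (sumFin n (f ∘ F.suc)) (sumFin n (g ∘ F.suc))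

  sumFin-*ˡ : ∀ n c (f : Fin n → ℕ) → sumFin n (λ x → c * f x) ≡ c * sumFin n f
  sumFin-*ˡ zero c f = sym (*-zeroʳ c)
  sumFin-*ˡ (suc n) c f rewrite sumFin-*ˡ n c (f ∘ F.suc) = sym (*-distribˡ-+ c (f F.zero) _)

  sumFin-const : ∀ n c → sumFin n (λ _ → c) ≡ n * c
  sumFin-const zero c = refl
  sumFin-const (suc n) c = cong (c +_) (sumFin-const n c)

  sumFin-0 : ∀ n → sumFin n (λ _ → 0) ≡ 0
  sumFin-0 n = trans (sumFin-const n 0) (*-zeroʳ n)

  sumFin-prod : ∀ n (f g : Fin n → ℕ) →
    sumFin n (λ x → sumFin n (λ y → f x * g y)) ≡ sumFin n f * sumFin n g
  sumFin-prod n f g = begin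
    sumFin n (λ x → sumFin n (λ y → f x * g y)) ≡⟨ sumFin-cong n (λ x → sumFin-*ˡ n (f x) g) ⟩
    sumFin n (λ x → f x * sumFin n g)            ≡⟨ sumFin-cong n (λ x → *-comm (f x) _) ⟩
    sumFin n (λ x → sumFin n g * f x)            ≡⟨ sumFin-*ˡ n (sumFin n g) f ⟩
    sumFin n g * sumFin n f                      ≡⟨ *-comm (sumFin n g) _ ⟩
    sumFin n f * sumFin n g                      ∎
    where open ≡-Reasoning

  dsum-mono : ∀ n {f g : Fin n → Fin n → ℕ} → (∀ x y → f x y ≤ g x y) →
    sumFin n (λ x → sumFin n (f x)) ≤ sumFin n (λ x → sumFin n (g x))
  dsum-mono n h = sumFin-mono n (λ x → sumFin-mono n (h x))

  dsum-+ : ∀ n (f g : Fin n → Fin n → ℕ) →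
    sumFin n (λ x → sumFin n (λ y → f x y + g x y))
      ≡ sumFin n (λ x → sumFin n (f x)) + sumFin n (λ x → sumFin n (g x))
  dsum-+ n f g = trans (sumFin-cong n (λ x → sumFin-+ n (f x) (g x))) (sumFin-+ n _ _)

  -- Reindexing a sum along an involution of Fin n does not change it
  -- (an involution is a permutation; the library knows sums are invariant).
  sumFin-invol : ∀ n (σ : Fin n → Fin n) → (∀ x → σ (σ x) ≡ x) → (f : Fin n → ℕ) →
    sumFin n (f ∘ σ) ≡ sumFin n f
  sumFin-invol n σ inv f =
    trans (asSum n (f ∘ σ)) (trans (sym (Sum.sum-permute f (permutation σ σ inv inv))) (sym (asSum n f)))
    where
    module Sum = MonoidSum +-0-commutativeMonoid
    asSum : ∀ m (g : Fin m → ℕ) → sumFin m g ≡ Sum.sum g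
    asSum zero g = refl
    asSum (suc m) g = cong (g F.zero +_) (asSum m (g ∘ F.suc))

  Σ𝟙 : ∀ n → (Fin n → Bool) → ℕ
  Σ𝟙 n f = sumFin n (λ x → 𝟙 (f x))

  𝟙≤1 : ∀ b → 𝟙 b ≤ 1
  𝟙≤1 true = s≤s z≤n
  𝟙≤1 false = z≤n

  Σ𝟙≤n : ∀ n (f : Fin n → Bool) → Σ𝟙 n f ≤ n
  Σ𝟙≤n n f = subst (Σ𝟙 n f ≤_) (trans (sumFin-const n 1) (*-identityʳ n)) (sumFin-mono n (λ x → 𝟙≤1 (f x)))

  Σ𝟙-compl : ∀ n (f : Fin n → Bool) → Σ𝟙 n f + Σ𝟙 n (λ x → not (f x)) ≡ n
  Σ𝟙-compl n f = trans (sym (sumFin-+ n _ _)) (trans (sumFin-cong n (λ x → 𝟙-not (f x)))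
                   (trans (sumFin-const n 1) (*-identityʳ n)))
    where
    𝟙-not : ∀ b → 𝟙 b + 𝟙 (not b) ≡ 1
    𝟙-not true = refl
    𝟙-not false = refl

  𝟙-split : ∀ s m → (s ≡ true → m ≡ true) → 𝟙 m ≡ 𝟙 s + 𝟙 (m ∧ not s)
  𝟙-split true m h rewrite h refl = refl
  𝟙-split false true h = refl
  𝟙-split false false h = refl

  ≟⇒≡ : ∀ {n} {x y : Fin n} → ⌊ x F.≟ y ⌋ ≡ true → x ≡ y
  ≟⇒≡ {x = x} {y} e with x F.≟ y
  ... | yes p = p
  ≟⇒≡ {x = x} {y} () | no _

  ≡⇒≟ : ∀ {n} {x y : Fin n} → x ≡ y → ⌊ x F.≟ y ⌋ ≡ true
  ≡⇒≟ {x = x} {y} p with x F.≟ y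
  ... | yes _ = refl
  ... | no np = ⊥-elim (np p)

  ≢⇒≟ : ∀ {n} {x y : Fin n} → x ≢ y → ⌊ x F.≟ y ⌋ ≡ false
  ≢⇒≟ {x = x} {y} np with x F.≟ y
  ... | yes p = ⊥-elim (np p)
  ... | no _ = refl

  Σ𝟙-single : ∀ n (a : Fin n) → Σ𝟙 n (λ x → ⌊ x F.≟ a ⌋) ≡ 1
  Σ𝟙-single (suc n) F.zero = cong suc (sumFin-0 n)
  Σ𝟙-single (suc n) (F.suc a) = trans (sumFin-cong n shift) (Σ𝟙-single n a)
    where
    shift : ∀ x → 𝟙 ⌊ F.suc x F.≟ F.suc a ⌋ ≡ 𝟙 ⌊ x F.≟ a ⌋
    shift x with x F.≟ a
    ... | yes refl = refl
    ... | no _ = refl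

  _⊆ᵇ_ : ∀ {n} → (Fin n → Bool) → (Fin n → Bool) → Set
  f ⊆ᵇ g = ∀ x → f x ≡ true → g x ≡ true

  Σ𝟙-mono : ∀ n {f g : Fin n → Bool} → f ⊆ᵇ g → Σ𝟙 n f ≤ Σ𝟙 n g
  Σ𝟙-mono n h = sumFin-mono n (λ x → 𝟙-mono (h x))
    where
    𝟙-mono : ∀ {a b} → (a ≡ true → b ≡ true) → 𝟙 a ≤ 𝟙 b
    𝟙-mono {false} _ = z≤n
    𝟙-mono {true} h rewrite h refl = ≤-refl

  Between : ∀ n → (lo hi : Fin n → Bool) → ℕ → Set
  Between n lo hi t = Σ (Fin n → Bool) λ mid → lo ⊆ᵇ mid × mid ⊆ᵇ hi × Σ𝟙 n mid ≡ t

  _◂_ : ∀ {n} → Bool → (Fin n → Bool) → Fin (suc n) → Bool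
  (b ◂ f) F.zero = b
  (b ◂ f) (F.suc x) = f x

  extendBetween : ∀ {n} {lo hi : Fin (suc n) → Bool} {t} (b : Bool) →
    (lo F.zero ≡ true → b ≡ true) → (b ≡ true → hi F.zero ≡ true) →
    Between n (lo ∘ F.suc) (hi ∘ F.suc) t → Between (suc n) lo hi (𝟙 b + t)
  extendBetween b lo⇒b b⇒hi (mid , lo⊆ , ⊆hi , size) =
    b ◂ mid , (λ { F.zero → lo⇒b ; (F.suc x) → lo⊆ x }) , (λ { F.zero → b⇒hi ; (F.suc x) → ⊆hi x }) ,
    cong (𝟙 b +_) size

  -- Vertex 0 is
  -- taken when lo forces it or when the rest of hi is too small without it.
  interpolate : ∀ n (lo hi : Fin n → Bool) → lo ⊆ᵇ hi → ∀ t → Σ𝟙 n lo ≤ t → t ≤ Σ𝟙 n hi →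
    Between n lo hi t
  interpolate zero lo hi sub t l1 l2 = (λ ()) , (λ ()) , (λ ()) , sym (n≤0⇒n≡0 l2)
  interpolate (suc n) lo hi sub t l1 l2 with lo F.zero in e1 | hi F.zero in e2
  ... | true | false = ⊥-elim (true≢false (trans (sym (sub F.zero e1)) e2))
    where true≢false : true ≢ false
          true≢false ()
  ... | true | true with t
  ...   | zero = ⊥-elim (1+n≰0 l1)
    where 1+n≰0 : ∀ {m} → suc m ≤ 0 → ⊥
          1+n≰0 ()
  ...   | suc t' = extendBetween true (λ _ → refl) (λ _ → e2)
                     (interpolate n (lo ∘ F.suc) (hi ∘ F.suc) (sub ∘ F.suc) t' (N.s≤s⁻¹ l1) (N.s≤s⁻¹ l2))
  interpolate (suc n) lo hi sub t l1 l2 | false | hi₀ with t N.≤? Σ𝟙 n (hi ∘ F.suc)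
  ... | yes t≤rest = extendBetween false (λ e → trans (sym e1) e) (λ ())
                       (interpolate n (lo ∘ F.suc) (hi ∘ F.suc) (sub ∘ F.suc) t l1 t≤rest)
  ... | no t>rest with hi₀ | t
  ...   | false | _ = ⊥-elim (t>rest l2)
  ...   | true | zero = ⊥-elim (t>rest z≤n)
  ...   | true | suc t' = extendBetween true (λ _ → refl) (λ _ → e2)
                            (interpolate n (lo ∘ F.suc) (hi ∘ F.suc) (sub ∘ F.suc) t'
                               (≤-trans (Σ𝟙-mono n (sub ∘ F.suc)) (N.s≤s⁻¹ (≰⇒> t>rest))) (N.s≤s⁻¹ l2))

  toSub : ∀ {n} → (Fin n → Bool) → Subset n
  toSub {zero} f = []
  toSub {suc n} f = f F.zero ∷ toSub (f ∘ F.suc)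

  mem-toSub : ∀ {n} (f : Fin n → Bool) x → mem x (toSub f) ≡ f x
  mem-toSub {suc n} f F.zero with f F.zero
  ... | true = refl
  ... | false = refl
  mem-toSub {suc n} f (F.suc x) with x ∈? toSub (f ∘ F.suc) | mem-toSub (f ∘ F.suc) x
  ... | yes _ | e = e
  ... | no _ | e = e

  size-toSub : ∀ {n} (f : Fin n → Bool) → ∣ toSub f ∣ ≡ Σ𝟙 n f
  size-toSub {zero} f = refl
  size-toSub {suc n} f with f F.zero
  ... | true = cong suc (size-toSub (f ∘ F.suc))
  ... | false = size-toSub (f ∘ F.suc)


-- The theorem is stated over ℚ; everything else happens in ℕ.  With
-- γ = P/Q, the degree condition and the conclusion become the ℕ-inequalities
-- below.
module RationalBridge where

  open import Data.Nat as N using (ℕ; suc)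
  import Data.Nat.Properties as NP
  open import Data.Integer as Z using (+_)
  import Data.Integer.Properties as ZP
  open import Data.Rational as Q using (ℚ; mkℚ)
  import Data.Rational.Properties as QP
  open import Data.Rational.Unnormalised as U using (mkℚᵘ; *≡*; *≤*)
  import Data.Rational.Unnormalised.Properties as UP
  open import Data.Product using (Σ; _,_)
  open import Relation.Binary.PropositionalEquality
  open import Data.Integer.Solver using (module +-*-Solver)
  open +-*-Solver
  import Data.Rational.Solver
  module RS = Data.Rational.Solver.+-*-Solver

  ι : ℕ → ℚ
  ι = ℕ→ℚ

  ι-unnorm : ∀ a → Q.toℚᵘ (ι a) U.≃ mkℚᵘ (+ a) 0
  ι-unnorm a = QP.toℚᵘ-fromℚᵘ (mkℚᵘ (+ a) 0)

  ι-mono : ∀ {a b} → a N.≤ b → ι a Q.≤ ι b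
  ι-mono {a} {b} le = QP.toℚᵘ-cancel-≤
    (UP.≤-respˡ-≃ (UP.≃-sym (ι-unnorm a)) (UP.≤-respʳ-≃ (UP.≃-sym (ι-unnorm b))
      (*≤* (subst₂ Z._≤_ (sym (ZP.*-identityʳ (+ a))) (sym (ZP.*-identityʳ (+ b))) (Z.+≤+ le)))))

  ι-reflect : ∀ {a b} → ι a Q.≤ ι b → a N.≤ b
  ι-reflect {a} {b} le with UP.≤-respˡ-≃ (ι-unnorm a) (UP.≤-respʳ-≃ (ι-unnorm b) (QP.toℚᵘ-mono-≤ le))
  ... | *≤* z = ZP.drop‿+≤+ (subst₂ Z._≤_ (ZP.*-identityʳ (+ a)) (ZP.*-identityʳ (+ b)) z)

  ι-+ : ∀ a b → ι (a N.+ b) ≡ ι a Q.+ ι b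
  ι-+ a b = QP.toℚᵘ-injective
    (UP.≃-trans (ι-unnorm (a N.+ b)) (UP.≃-trans unnorm
      (UP.≃-trans (UP.+-cong (UP.≃-sym (ι-unnorm a)) (UP.≃-sym (ι-unnorm b)))
                  (UP.≃-sym (QP.toℚᵘ-homo-+ (ι a) (ι b))))))
    where
    unnorm : mkℚᵘ (+ (a N.+ b)) 0 U.≃ (mkℚᵘ (+ a) 0 U.+ mkℚᵘ (+ b) 0)
    unnorm = *≡* (trans (cong (Z._* + 1) (ZP.pos-+ a b))
      (solve 2 (λ A B → (A :+ B) :* con (+ 1) := (A :* con (+ 1) :+ B :* con (+ 1)) :* con (+ 1)) refl (+ a) (+ b)))

  ι-* : ∀ a b → ι (a N.* b) ≡ ι a Q.* ι b
  ι-* a b = QP.toℚᵘ-injective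
    (UP.≃-trans (ι-unnorm (a N.* b)) (UP.≃-trans unnorm
      (UP.≃-trans (UP.*-cong (UP.≃-sym (ι-unnorm a)) (UP.≃-sym (ι-unnorm b)))
                  (UP.≃-sym (QP.toℚᵘ-homo-* (ι a) (ι b))))))
    where
    unnorm : mkℚᵘ (+ (a N.* b)) 0 U.≃ (mkℚᵘ (+ a) 0 U.* mkℚᵘ (+ b) 0)
    unnorm = *≡* (trans (cong (Z._* + 1) (ZP.pos-* a b))
      (solve 2 (λ A B → (A :* B) :* con (+ 1) := (A :* B) :* con (+ 1)) refl (+ a) (+ b)))

  positive-fraction : (γ : ℚ) → Q.0ℚ Q.< γ → Σ ℕ λ p → Σ ℕ λ q → γ Q.* ι (suc q) ≡ ι (suc p)
  positive-fraction (mkℚ (Z.+[1+ p ]) q c) _ = p , q , QP.toℚᵘ-injective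
    (UP.≃-trans (QP.toℚᵘ-homo-* (mkℚ (Z.+[1+ p ]) q c) (ι (suc q)))
     (UP.≃-trans (UP.*-cong (UP.≃-refl {mkℚᵘ (+ suc p) q}) (ι-unnorm (suc q)))
      (UP.≃-trans cancel (UP.≃-sym (ι-unnorm (suc p))))))
    where
    cancel : (mkℚᵘ (+ suc p) q U.* mkℚᵘ (+ suc q) 0) U.≃ mkℚᵘ (+ suc p) 0
    cancel = *≡* (trans (solve 2 (λ P Q → (P :* Q) :* con (+ 1) := P :* (Q :* con (+ 1))) refl (+ suc p) (+ suc q))
       (cong (+ suc p Z.*_) (sym (ZP.pos-* (suc q) 1))))
  positive-fraction (mkℚ (+ 0) q c) (Q.*<* (Z.+<+ ()))
  positive-fraction (mkℚ (Z.-[1+ k ]) q c) (Q.*<* ())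

  degree-condition-ℕ : ∀ (γ : ℚ) P Qn n d → γ Q.* ι Qn ≡ ι P →
    (Q.½ Q.- γ) Q.* ι n Q.≤ ι d → Qn N.* n N.≤ 2 N.* Qn N.* d N.+ 2 N.* P N.* n
  degree-condition-ℕ γ P Qn n d γQ≡P deg = ι-reflect (subst₂ Q._≤_ cancelY (sym sumℕ) addY)
    where
    open ≡-Reasoning
    M : ℕ
    M = 2 N.* Qn
    scaled : (Q.½ Q.- γ) Q.* ι n Q.* ι M Q.≤ ι d Q.* ι M
    scaled = QP.*-monoʳ-≤-nonNeg (ι M) {{QP.normalize-nonNeg M 1}} deg
    X Y : ℚ
    X = ι (Qn N.* n)
    Y = ι (2 N.* P N.* n)
    lhs : (Q.½ Q.- γ) Q.* ι n Q.* ι M ≡ X Q.- Y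
    lhs = begin
      (Q.½ Q.- γ) Q.* ι n Q.* ι M
        ≡⟨ cong (λ z → (Q.½ Q.- γ) Q.* ι n Q.* z) (ι-* 2 Qn) ⟩
      (Q.½ Q.- γ) Q.* ι n Q.* (ι 2 Q.* ι Qn)
        ≡⟨ RS.solve 5 (λ h g N T R → (h RS.:- g) RS.:* N RS.:* (T RS.:* R)
                          RS.:= (h RS.:* T) RS.:* R RS.:* N RS.:- T RS.:* (g RS.:* R) RS.:* N)
             refl Q.½ γ (ι n) (ι 2) (ι Qn) ⟩
      (Q.½ Q.* ι 2) Q.* ι Qn Q.* ι n Q.- ι 2 Q.* (γ Q.* ι Qn) Q.* ι n
        ≡⟨ cong (λ b → Q.1ℚ Q.* ι Qn Q.* ι n Q.- ι 2 Q.* b Q.* ι n) γQ≡P ⟩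
      Q.1ℚ Q.* ι Qn Q.* ι n Q.- ι 2 Q.* ι P Q.* ι n
        ≡⟨ cong₂ Q._-_ (trans (cong (Q._* ι n) (QP.*-identityˡ (ι Qn))) (sym (ι-* Qn n)))
                       (sym (trans (ι-* (2 N.* P) n) (cong (Q._* ι n) (ι-* 2 P)))) ⟩
      X Q.- Y ∎
    addY : X Q.- Y Q.+ Y Q.≤ ι (d N.* M) Q.+ Y
    addY = QP.+-monoˡ-≤ Y (subst₂ Q._≤_ lhs (sym (ι-* d M)) scaled)
    cancelY : X Q.- Y Q.+ Y ≡ X
    cancelY = RS.solve 2 (λ x y → x RS.:- y RS.:+ y RS.:= x) refl X Y
    sumℕ : ι (2 N.* Qn N.* d N.+ 2 N.* P N.* n) ≡ ι (d N.* M) Q.+ Y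
    sumℕ = trans (cong (λ z → ι (z N.+ 2 N.* P N.* n)) (NP.*-comm M d)) (ι-+ (d N.* M) (2 N.* P N.* n))

  bound-ℚ : ∀ (γ : ℚ) P q e m → γ Q.* ι (suc q) ≡ ι P →
    suc q N.* e N.≤ 6 N.* P N.* m → ι e Q.≤ ι 6 Q.* γ Q.* ι m
  bound-ℚ γ P q e m γQ≡P le =
    QP.*-cancelˡ-≤-pos (ι (suc q)) {{QP.normalize-pos (suc q) 1}} (subst₂ Q._≤_ (ι-* (suc q) e) rhs (ι-mono le))
    where
    open ≡-Reasoning
    rhs : ι (6 N.* P N.* m) ≡ ι (suc q) Q.* (ι 6 Q.* γ Q.* ι m)
    rhs = begin
      ι (6 N.* P N.* m)                   ≡⟨ trans (ι-* (6 N.* P) m) (cong (Q._* ι m) (ι-* 6 P)) ⟩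
      ι 6 Q.* ι P Q.* ι m                 ≡⟨ cong (λ z → ι 6 Q.* z Q.* ι m) (sym γQ≡P) ⟩
      ι 6 Q.* (γ Q.* ι (suc q)) Q.* ι m
        ≡⟨ RS.solve 4 (λ a g r c → a RS.:* (g RS.:* r) RS.:* c RS.:= r RS.:* (a RS.:* g RS.:* c))
             refl (ι 6) γ (ι (suc q)) (ι m) ⟩
      ι (suc q) Q.* (ι 6 Q.* γ Q.* ι m)   ∎


module BoolFacts where

  open import Data.Bool using (true; false; _∧_; _∨_)
  open import Data.Product using (_×_; _,_)
  open import Data.Sum using (_⊎_; inj₁; inj₂)
  open import Data.Empty using (⊥; ⊥-elim)
  open import Relation.Binary.PropositionalEquality

  ∧-el : ∀ {a b} → a ∧ b ≡ true → a ≡ true × b ≡ true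
  ∧-el {true} {true} _ = refl , refl

  ∧-in : ∀ {a b} → a ≡ true → b ≡ true → a ∧ b ≡ true
  ∧-in refl refl = refl

  ∨-el : ∀ {a b} → a ∨ b ≡ true → a ≡ true ⊎ b ≡ true
  ∨-el {true} _ = inj₁ refl
  ∨-el {false} {true} _ = inj₂ refl

  ∨-inl : ∀ {a} b → a ≡ true → a ∨ b ≡ true
  ∨-inl b refl = refl

  ∨-inr : ∀ a {b} → b ≡ true → a ∨ b ≡ true
  ∨-inr true refl = refl
  ∨-inr false refl = refl

  t≢f : ∀ {b} → b ≡ true → b ≡ false → ⊥
  t≢f refl ()

  ¬t⇒f : ∀ {b} → (b ≡ true → ⊥) → b ≡ false
  ¬t⇒f {true} h = ⊥-elim (h refl)
  ¬t⇒f {false} h = refl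

  true-or-false : ∀ b → b ≡ true ⊎ b ≡ false
  true-or-false true = inj₁ refl
  true-or-false false = inj₂ refl


-- The linear arithmetic of the counting argument, with γ = P/Q and n = 2h.
-- A degree bound Qn ≤ 2Q·d + 2Pn says d ≥ (1/2 - P/Q)n.
module Inequalities where

  open import Data.Nat using (_+_; _*_; _≤_)
  open import Data.Nat.Properties
  open import Relation.Binary.PropositionalEquality
  open import Data.Nat.Solver using (module +-*-Solver)
  open +-*-Solver

  few-unmatched-and-low : ∀ {Q P n s du dv L U} → 2 * s + L + 2 * U ≤ 2 * n →
    Q * n ≤ 2 * Q * du + 2 * P * n → Q * n ≤ 2 * Q * dv + 2 * P * n → s ≡ du + dv →
    2 * Q * U + Q * L ≤ 4 * P * n
  few-unmatched-and-low {Q} {P} {n} {s} {du} {dv} {L} {U} total du-large dv-large refl =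
    +-cancelˡ-≤ (2 * Q * s) _ _ (begin
      2 * Q * s + (2 * Q * U + Q * L)
        ≡⟨ solve 4 (λ Q s U L → con 2 :* Q :* s :+ (con 2 :* Q :* U :+ Q :* L)
                                := Q :* (con 2 :* s :+ L :+ con 2 :* U)) refl Q s U L ⟩
      Q * (2 * s + L + 2 * U)  ≤⟨ *-monoʳ-≤ Q total ⟩
      Q * (2 * n)              ≡⟨ solve 2 (λ Q n → Q :* (con 2 :* n) := Q :* n :+ Q :* n) refl Q n ⟩
      Q * n + Q * n            ≤⟨ +-mono-≤ du-large dv-large ⟩
      (2 * Q * du + 2 * P * n) + (2 * Q * dv + 2 * P * n)
        ≡⟨ solve 5 (λ Q P n du dv → (con 2 :* Q :* du :+ con 2 :* P :* n) :+ (con 2 :* Q :* dv :+ con 2 :* P :* n)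
                                    := con 2 :* Q :* (du :+ dv) :+ con 4 :* P :* n) refl Q P n du dv ⟩
      2 * Q * s + 4 * P * n    ∎)
    where open ≤-Reasoning

  -- A vertex of degree ≥ (1/2 - γ)n whose neighbours lie in a set of size c
  -- or among L vertices, where L ≤ 4γn: then c ≥ h - 6γn, i.e. if
  -- h = c + X then X ≤ 6γn.
  deficit-bound : ∀ {Q P n c L h X} → Q * L ≤ 4 * P * n → Q * n ≤ 2 * Q * (c + L) + 2 * P * n →
    n ≡ h + h → h ≡ c + X → Q * X ≤ 6 * P * n
  deficit-bound {Q} {P} {n} {c} {L} {h} {X} low-few deg refl refl = *-cancelˡ-≤ 2 (begin
    2 * (Q * X) ≤⟨ +-cancelˡ-≤ (2 * Q * c) _ _ (begin
      2 * Q * c + 2 * (Q * X)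
        ≡⟨ solve 3 (λ Q c X → con 2 :* Q :* c :+ con 2 :* (Q :* X) := Q :* ((c :+ X) :+ (c :+ X))) refl Q c X ⟩
      Q * ((c + X) + (c + X)) ≤⟨ deg ⟩
      2 * Q * (c + L) + 2 * P * n
        ≡⟨ solve 5 (λ Q c L P n → con 2 :* Q :* (c :+ L) :+ con 2 :* P :* n
                                  := con 2 :* Q :* c :+ (con 2 :* (Q :* L) :+ con 2 :* P :* n)) refl Q c L P n ⟩
      2 * Q * c + (2 * (Q * L) + 2 * P * n)
        ≤⟨ +-monoʳ-≤ (2 * Q * c) (+-monoˡ-≤ (2 * P * n) (*-monoʳ-≤ 2 low-few)) ⟩
      2 * Q * c + (2 * (4 * P * n) + 2 * P * n) ∎) ⟩
    2 * (4 * P * n) + 2 * P * n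
      ≡⟨ solve 2 (λ P n → con 2 :* (con 4 :* P :* n) :+ con 2 :* P :* n := con 10 :* P :* n) refl P n ⟩
    10 * P * n ≤⟨ *-monoˡ-≤ n (*-monoˡ-≤ P {10} {12} (m≤m+n 10 2)) ⟩
    12 * P * n ≡⟨ solve 2 (λ P n → con 12 :* P :* n := con 2 :* (con 6 :* P :* n)) refl P n ⟩
    2 * (6 * P * n) ∎)
    where open ≤-Reasoning

  -- Padding a set by t ≤ 6γn vertices up to size h costs ≤ 6γn² edges.
  padding-bound : ∀ {Q P n h t} → n ≡ h + h → Q * t ≤ 6 * P * n → Q * (t * h + h * t) ≤ 6 * P * (n * n)
  padding-bound {Q} {P} {n} {h} {t} refl le = begin
    Q * (t * h + h * t)   ≡⟨ solve 3 (λ Q t h → Q :* (t :* h :+ h :* t) := (Q :* t) :* (h :+ h)) refl Q t h ⟩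
    (Q * t) * (h + h)     ≤⟨ *-monoˡ-≤ (h + h) le ⟩
    6 * P * (h + h) * (h + h)
      ≡⟨ solve 2 (λ P n → con 6 :* P :* n :* n := con 6 :* P :* (n :* n)) refl P (h + h) ⟩
    6 * P * ((h + h) * (h + h)) ∎
    where open ≤-Reasoning

  -- A cut whose two sides each miss X₁ resp. X₂ vertices of the
  -- edgeless parts, with X₁ + X₂ ≤ 6γn, has ≤ 6γn² crossing edges.
  cut-bound : ∀ {Q P n h X1 X2} → n ≡ h + h → Q * (X1 + X2) ≤ 6 * P * n →
    Q * ((X1 * h + h * X2) + (X2 * h + h * X1)) ≤ 6 * P * (n * n)
  cut-bound {Q} {P} {n} {h} {X1} {X2} refl le = begin
    Q * ((X1 * h + h * X2) + (X2 * h + h * X1))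
      ≡⟨ solve 4 (λ Q h a b → Q :* ((a :* h :+ h :* b) :+ (b :* h :+ h :* a)) := (Q :* (a :+ b)) :* (h :+ h))
           refl Q h X1 X2 ⟩
    (Q * (X1 + X2)) * (h + h) ≤⟨ *-monoˡ-≤ (h + h) le ⟩
    6 * P * (h + h) * (h + h)
      ≡⟨ solve 2 (λ P n → con 6 :* P :* n :* n := con 6 :* P :* (n :* n)) refl P (h + h) ⟩
    6 * P * ((h + h) * (h + h)) ∎
    where open ≤-Reasoning


module Matchings {n : ℕ} (G : Digraph n) where

  open import Data.Nat using (_≤_; _<_; z≤n; s≤s)
  open import Data.Nat.Properties using (≤-refl)
  open import Data.Bool using (Bool; true; false; _∨_)
  open import Data.Bool.Properties using (∨-comm)
  open import Data.Fin using (Fin; _≟_)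
  open import Data.Maybe using (Maybe; just; nothing)
  open import Data.List using (List; []; _∷_)
  open import Data.List.Relation.Unary.All using (All; []; _∷_)
  open import Data.List.Relation.Unary.All.Properties using (All¬⇒¬Any)
  open import Data.List.Relation.Unary.Any using (here; there)
  open import Data.List.Relation.Unary.AllPairs using ([]; _∷_)
  open import Data.List.Relation.Unary.Unique.Propositional using (Unique)
  open import Data.List.Membership.Propositional using (_∈_; _∉_)
  open import Data.Product using (Σ; _×_; _,_; proj₁; proj₂)
  open import Relation.Binary.PropositionalEquality
  open import Relation.Nullary.Decidable using (⌊_⌋)
  open import Relation.Nullary using (yes; no)
  open import Data.Empty using (⊥; ⊥-elim)
  open FinSums

  adjH : Fin n → Fin n → Bool
  adjH x y = adj G x y ∨ adj G y x

  adjH-sym : ∀ x y → adjH x y ≡ adjH y x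
  adjH-sym x y = ∨-comm (adj G x y) (adj G y x)

  adjH-irr : ∀ x → adjH x x ≡ false
  adjH-irr x rewrite loopless G x = refl

  degH : Fin n → ℕ
  degH x = sumFin n (λ y → 𝟙 (adjH x y))

  out≤degH : ∀ x → outdeg G x ≤ degH x
  out≤degH x = sumFin-mono n (λ y → 𝟙∨ˡ (adj G x y) (adj G y x))
    where
    𝟙∨ˡ : ∀ a b → 𝟙 a ≤ 𝟙 (a ∨ b)
    𝟙∨ˡ true b = s≤s z≤n
    𝟙∨ˡ false b = z≤n

  in≤degH : ∀ x → indeg G x ≤ degH x
  in≤degH x = sumFin-mono n (λ y → 𝟙∨ʳ (adj G x y) (adj G y x))
    where
    𝟙∨ʳ : ∀ a b → 𝟙 b ≤ 𝟙 (a ∨ b)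
    𝟙∨ʳ true b = 𝟙≤1 b
    𝟙∨ʳ false b = ≤-refl

  -- A matching of H as an involution: σ x is the partner of x, and
  -- σ x = x exactly when x is unmatched.
  record Matching : Set where
    field
      σ   : Fin n → Fin n
      inv : ∀ x → σ (σ x) ≡ x
      ed  : ∀ x → σ x ≢ x → adjH x (σ x) ≡ true

  open Matching public

  unmatched : Matching → Fin n → Bool
  unmatched M x = ⌊ σ M x ≟ x ⌋

  countUnmatched : Matching → ℕ
  countUnmatched M = Σ𝟙 n (unmatched M)

  Improvement : Matching → Set
  Improvement M = Σ Matching λ M' → countUnmatched M' < countUnmatched M

  emptyMatching : Matching
  emptyMatching = record { σ = λ x → x ; inv = λ x → refl ; ed = λ x ne → ⊥-elim (ne refl) }

  Matched : Matching → Fin n → Set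
  Matched M x = σ M x ≢ x

  matched≢unmatched : (M : Matching) {x y : Fin n} → Matched M x → σ M y ≡ y → x ≢ y
  matched≢unmatched M mx fy refl = mx fy

  matched-σ : (M : Matching) {x : Fin n} → Matched M x → Matched M (σ M x)
  matched-σ M {x} mx e = mx (trans (sym e) (inv M x))

  σ-inj : (M : Matching) {x y : Fin n} → σ M x ≡ σ M y → x ≡ y
  σ-inj M {x} {y} e = trans (sym (inv M x)) (trans (cong (σ M) e) (inv M y))

  sym≢ : {x y : Fin n} → x ≢ y → y ≢ x
  sym≢ ne e = ne (sym e)

  -- An alternating path is given as its list of new edges (a , b); along
  -- it the new partner of a vertex is looked up with `partner`.
  Pairs : Set
  Pairs = List (Fin n × Fin n)

  flat : Pairs → List (Fin n)
  flat [] = []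
  flat ((a , b) ∷ ps) = a ∷ b ∷ flat ps

  partner : Fin n → Pairs → Maybe (Fin n)
  partner z [] = nothing
  partner z ((a , b) ∷ ps) with z ≟ a
  ... | yes _ = just b
  ... | no _ with z ≟ b
  ...   | yes _ = just a
  ...   | no _ = partner z ps

  partner-∈ : ∀ ps z y → partner z ps ≡ just y → z ∈ flat ps × y ∈ flat ps
  partner-∈ ((a , b) ∷ ps) z y eq with z ≟ a
  partner-∈ ((a , b) ∷ ps) z y refl | yes refl = here refl , there (here refl)
  ... | no _ with z ≟ b
  partner-∈ ((a , b) ∷ ps) z y refl | no _ | yes refl = there (here refl) , here refl
  ... | no _ with partner-∈ ps z y eq
  ... | p1 , p2 = there (there p1) , there (there p2)

  partner-∉ : ∀ ps z → partner z ps ≡ nothing → z ∉ flat ps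
  partner-∉ ((a , b) ∷ ps) z eq mem with z ≟ a
  partner-∉ ((a , b) ∷ ps) z () mem | yes _
  ... | no za with z ≟ b
  partner-∉ ((a , b) ∷ ps) z () mem | no za | yes _
  partner-∉ ((a , b) ∷ ps) z eq (here p) | no za | no zb = za p
  partner-∉ ((a , b) ∷ ps) z eq (there (here p)) | no za | no zb = zb p
  partner-∉ ((a , b) ∷ ps) z eq (there (there m)) | no za | no zb = partner-∉ ps z eq m

  partner-≢ : ∀ ps → Unique (flat ps) → ∀ z y → partner z ps ≡ just y → y ≢ z
  partner-≢ ((a , b) ∷ ps) ((a∉ ∷ _) ∷ (b∉ ∷ u)) z y eq with z ≟ a
  partner-≢ ((a , b) ∷ ps) ((a∉ ∷ _) ∷ (b∉ ∷ u)) z y refl | yes refl = λ e → a∉ (sym e)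
  ... | no _ with z ≟ b
  partner-≢ ((a , b) ∷ ps) ((a∉ ∷ _) ∷ (b∉ ∷ u)) z y refl | no _ | yes refl = a∉
  ... | no _ = partner-≢ ps u z y eq

  partner-sym : ∀ ps → Unique (flat ps) → ∀ z y → partner z ps ≡ just y → partner y ps ≡ just z
  partner-sym ((a , b) ∷ ps) ((a∉ ∷ a∉') ∷ (b∉ ∷ u)) z y eq with z ≟ a
  partner-sym ((a , b) ∷ ps) ((a∉ ∷ a∉') ∷ (b∉ ∷ u)) z y refl | yes refl with b ≟ a
  ... | yes e = ⊥-elim (a∉ (sym e))
  ... | no _ with b ≟ b
  ... | yes _ = refl
  ... | no ne = ⊥-elim (ne refl)
  partner-sym ((a , b) ∷ ps) ((a∉ ∷ a∉') ∷ (b∉ ∷ u)) z y eq | no za with z ≟ b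
  partner-sym ((a , b) ∷ ps) ((a∉ ∷ a∉') ∷ (b∉ ∷ u)) z y refl | no za | yes refl with a ≟ a
  ... | yes _ = refl
  ... | no ne = ⊥-elim (ne refl)
  partner-sym ((a , b) ∷ ps) ((a∉ ∷ a∉') ∷ (b∉ ∷ u)) z y eq | no za | no zb with partner-∈ ps z y eq
  ... | _ , yin with y ≟ a
  ... | yes refl = ⊥-elim (All¬⇒¬Any a∉' yin)
  ... | no _ with y ≟ b
  ... | yes refl = ⊥-elim (All¬⇒¬Any b∉ yin)
  ... | no _ = partner-sym ps u z y eq

  partner-just : ∀ ps z → z ∈ flat ps → Σ (Fin n) λ y → partner z ps ≡ just y
  partner-just ((a , b) ∷ ps) z m with z ≟ a
  ... | yes _ = b , refl
  ... | no za with z ≟ b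
  ... | yes _ = a , refl
  partner-just ((a , b) ∷ ps) z (here p) | no za | no zb = ⊥-elim (za p)
  partner-just ((a , b) ∷ ps) z (there (here p)) | no za | no zb = ⊥-elim (zb p)
  partner-just ((a , b) ∷ ps) z (there (there m)) | no za | no zb = partner-just ps z m

  AllLinked : Pairs → Set
  AllLinked ps = All (λ p → adjH (proj₁ p) (proj₂ p) ≡ true) ps

  partner-adj : ∀ ps → AllLinked ps → ∀ z y → partner z ps ≡ just y → adjH z y ≡ true
  partner-adj ((a , b) ∷ ps) (e ∷ es) z y eq with z ≟ a
  partner-adj ((a , b) ∷ ps) (e ∷ es) z y refl | yes refl = e
  ... | no _ with z ≟ b
  partner-adj ((a , b) ∷ ps) (e ∷ es) z y refl | no _ | yes refl = trans (adjH-sym b a) e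
  ... | no _ = partner-adj ps es z y eq

  pick : Maybe (Fin n) → Fin n → Fin n
  pick (just y) _ = y
  pick nothing z = z

  augment : (M : Matching) (ps : Pairs) → Unique (flat ps) → AllLinked ps →
    (∀ z → z ∈ flat ps → σ M z ∈ flat ps) →
    (w : Fin n) → w ∈ flat ps → σ M w ≡ w →
    Improvement M
  augment M ps u aa cl w win fw = M' , lt
    where
    s' : Fin n → Fin n
    s' z = pick (partner z ps) (σ M z)
    inv' : ∀ z → s' (s' z) ≡ z
    inv' z with partner z ps in eq
    ... | just y rewrite partner-sym ps u z y eq = refl
    ... | nothing with partner (σ M z) ps in eq2
    ... | just y' = ⊥-elim (partner-∉ ps z eq (subst (_∈ flat ps) (inv M z) (cl (σ M z) (proj₁ (partner-∈ ps (σ M z) y' eq2)))))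
    ... | nothing = inv M z
    ed' : ∀ z → s' z ≢ z → adjH z (s' z) ≡ true
    ed' z ne with partner z ps in eq
    ... | just y = partner-adj ps aa z y eq
    ... | nothing = ed M z ne
    M' : Matching
    M' = record { σ = s' ; inv = inv' ; ed = ed' }
    pw : ∀ x → 𝟙 (unmatched M' x) ≤ 𝟙 (unmatched M x)
    pw x with partner x ps in eq
    ... | just y = subst (_≤ 𝟙 (unmatched M x)) (sym (cong 𝟙 (≢⇒≟ (partner-≢ ps u x y eq)))) z≤n
    ... | nothing = ≤-refl
    st : 𝟙 (unmatched M' w) < 𝟙 (unmatched M w)
    st with partner-just ps w win
    ... | y , eq with partner w ps | eq
    ... | just .y | refl rewrite ≢⇒≟ (partner-≢ ps u w y eq) | ≡⇒≟ fw = s≤s z≤n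
    lt : countUnmatched M' < countUnmatched M
    lt = sumFin-strict n pw w st

  augment₁ : (M : Matching) (w w' : Fin n) → σ M w ≡ w → σ M w' ≡ w' → w ≢ w' → adjH w w' ≡ true →
    Improvement M
  augment₁ M w w' fw fw' ne e = augment M ((w , w') ∷ []) ((ne ∷ []) ∷ ([] ∷ [])) (e ∷ []) cl w (here refl) fw
    where
    cl : ∀ z → z ∈ (w ∷ w' ∷ []) → σ M z ∈ (w ∷ w' ∷ [])
    cl z (here refl) = here fw
    cl z (there (here refl)) = there (here fw')

  augment₃ : (M : Matching) (w a w' : Fin n) → σ M w ≡ w → σ M w' ≡ w' → w ≢ w' → Matched M a →
    adjH w a ≡ true → adjH (σ M a) w' ≡ true → Improvement M
  augment₃ M w a w' fw fw' ne ma e1 e2 =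
    augment M ((w , a) ∷ (σ M a , w') ∷ []) uq (e1 ∷ e2 ∷ []) cl w (here refl) fw
    where
    b : Fin n
    b = σ M a
    mb : Matched M b
    mb = matched-σ M ma
    uq : Unique (w ∷ a ∷ b ∷ w' ∷ [])
    uq = (sym≢ (matched≢unmatched M ma fw) ∷ sym≢ (matched≢unmatched M mb fw) ∷ ne ∷ [])
       ∷ (sym≢ ma ∷ matched≢unmatched M ma fw' ∷ [])
       ∷ (matched≢unmatched M mb fw' ∷ [])
       ∷ [] ∷ []
    cl : ∀ z → z ∈ (w ∷ a ∷ b ∷ w' ∷ []) → σ M z ∈ (w ∷ a ∷ b ∷ w' ∷ [])
    cl z (here refl) = here fw
    cl z (there (here refl)) = there (there (here refl))
    cl z (there (there (here refl))) = there (here (inv M a))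
    cl z (there (there (there (here refl)))) = there (there (there (here fw')))

  augment₅ : (M : Matching) (u a c v : Fin n) → σ M u ≡ u → σ M v ≡ v → u ≢ v → Matched M a → Matched M c →
    c ≢ a → c ≢ σ M a →
    adjH u a ≡ true → adjH (σ M a) c ≡ true → adjH (σ M c) v ≡ true → Improvement M
  augment₅ M u a c v fu fv ne ma mc ca cb e1 e2 e3 =
    augment M ((u , a) ∷ (σ M a , c) ∷ (σ M c , v) ∷ []) uq (e1 ∷ e2 ∷ e3 ∷ []) cl u (here refl) fu
    where
    b d : Fin n
    b = σ M a
    d = σ M c
    mb : Matched M b
    mb = matched-σ M ma
    md : Matched M d
    md = matched-σ M mc
    ad : a ≢ d
    ad e = cb (trans (sym (inv M c)) (cong (σ M) (sym e)))
    bd : b ≢ d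
    bd e = ca (sym (σ-inj M e))
    uq : Unique (u ∷ a ∷ b ∷ c ∷ d ∷ v ∷ [])
    uq = (sym≢ (matched≢unmatched M ma fu) ∷ sym≢ (matched≢unmatched M mb fu) ∷ sym≢ (matched≢unmatched M mc fu) ∷ sym≢ (matched≢unmatched M md fu) ∷ ne ∷ [])
       ∷ (sym≢ ma ∷ sym≢ ca ∷ ad ∷ matched≢unmatched M ma fv ∷ [])
       ∷ (sym≢ cb ∷ bd ∷ matched≢unmatched M mb fv ∷ [])
       ∷ (sym≢ mc ∷ matched≢unmatched M mc fv ∷ [])
       ∷ (matched≢unmatched M md fv ∷ [])
       ∷ [] ∷ []
    cl : ∀ z → z ∈ (u ∷ a ∷ b ∷ c ∷ d ∷ v ∷ []) → σ M z ∈ (u ∷ a ∷ b ∷ c ∷ d ∷ v ∷ [])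
    cl z (here refl) = here fu
    cl z (there (here refl)) = there (there (here refl))
    cl z (there (there (here refl))) = there (here (inv M a))
    cl z (there (there (there (here refl)))) = there (there (there (there (here refl))))
    cl z (there (there (there (there (here refl))))) = there (there (there (here (inv M c))))
    cl z (there (there (there (there (there (here refl)))))) = there (there (there (there (there (here fv)))))


  NoPath₁ : Matching → Set
  NoPath₁ M = ∀ w w' → σ M w ≡ w → σ M w' ≡ w' → w ≢ w' → adjH w w' ≡ true → ⊥

  NoPath₃ : Matching → Set
  NoPath₃ M = ∀ w a w' → σ M w ≡ w → σ M w' ≡ w' → w ≢ w' → Matched M a →
    adjH w a ≡ true → adjH (σ M a) w' ≡ true → ⊥

  NoPath₅ : Matching → Fin n → Fin n → Set
  NoPath₅ M u v = ∀ a c → Matched M a → Matched M c → c ≢ a → c ≢ σ M a →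
    adjH u a ≡ true → adjH (σ M a) c ≡ true → adjH (σ M c) v ≡ true → ⊥

  ¬adjH⇒¬adj : ∀ {x y} → adjH x y ≡ false → adj G x y ≡ false
  ¬adjH⇒¬adj {x} {y} e with adj G x y | e
  ... | false | _ = refl
  ... | true | ()


-- A matching of H covering every vertex yields a perfect matching of G:
-- each pair {x, σ x} is oriented along an edge of G that joins them.
module PerfectMatchings {n : ℕ} (G : Digraph n) where

  open import Data.Nat using (suc; zero; _≤_; s≤s)
  open import Data.Nat.Properties using (≤-trans; ≤-reflexive)
  open import Data.Bool using (true; false)
  open import Data.Fin as F using (Fin; _≟_)
  open import Data.List using (List; []; _∷_; filter; length; allFin)
  open import Data.List.Properties using (length-filter; length-tabulate)
  open import Data.List.Relation.Unary.All using (All; []; _∷_)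
  open import Data.List.Relation.Unary.All.Properties using (All¬⇒¬Any; ¬Any⇒All¬)
  open import Data.List.Relation.Unary.Any using (here; there)
  open import Data.List.Relation.Unary.AllPairs using ([]; _∷_)
  open import Data.List.Relation.Unary.Unique.Propositional using (Unique)
  open import Data.List.Relation.Unary.Unique.Propositional.Properties using (filter⁺; allFin⁺)
  open import Data.List.Membership.Propositional using (_∈_; _∉_)
  open import Data.List.Membership.Propositional.Properties using (∈-filter⁺; ∈-filter⁻; ∈-allFin)
  open import Data.Product using (Σ; _×_; _,_; proj₁; proj₂)
  open import Relation.Binary.PropositionalEquality
  open import Relation.Nullary using (yes; no; ¬?)
  open import Data.Empty using (⊥-elim)
  open Matchings G

  _≈ˢ_ : List (Fin n) → List (Fin n) → Set
  xs ≈ˢ ys = (∀ z → z ∈ xs → z ∈ ys) × (∀ z → z ∈ ys → z ∈ xs)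

  MatchingOn : List (Fin n) → Set
  MatchingOn V = Σ (List (Fin n × Fin n)) λ E →
    All (λ e → adj G (proj₁ e) (proj₂ e) ≡ true) E × Unique (endpoints E) × endpoints E ≈ˢ V

  MatchingOn-resp : ∀ {V W} → V ≈ˢ W → MatchingOn V → MatchingOn W
  MatchingOn-resp (f , g) (E , ae , ue , s1 , s2) = E , ae , ue , (λ z m → f z (s1 z m)) , (λ z m → s2 z (g z m))

  cons-edge : ∀ (x y : Fin n) (V : List (Fin n)) → x ≢ y → adjH x y ≡ true →
    x ∉ V → y ∉ V → MatchingOn V → MatchingOn (x ∷ y ∷ V)
  cons-edge x y V ne xy∈H x∉V y∉V (E , ae , ue , s1 , s2) with adj G x y in x→y
  ... | true = (x , y) ∷ E , x→y ∷ ae , (¬Any⇒All¬ _ x∉ ∷ (¬Any⇒All¬ _ y∉ ∷ ue)) , c1 , c2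
    where
    x∉ : x ∉ (y ∷ endpoints E)
    x∉ (here e) = ne e
    x∉ (there m) = x∉V (s1 x m)
    y∉ : y ∉ endpoints E
    y∉ m = y∉V (s1 y m)
    c1 : ∀ z → z ∈ (x ∷ y ∷ endpoints E) → z ∈ (x ∷ y ∷ V)
    c1 z (here e) = here e
    c1 z (there (here e)) = there (here e)
    c1 z (there (there m)) = there (there (s1 z m))
    c2 : ∀ z → z ∈ (x ∷ y ∷ V) → z ∈ (x ∷ y ∷ endpoints E)
    c2 z (here e) = here e
    c2 z (there (here e)) = there (here e)
    c2 z (there (there m)) = there (there (s2 z m))
  ... | false = (y , x) ∷ E , xy∈H ∷ ae , (¬Any⇒All¬ _ y∉ ∷ (¬Any⇒All¬ _ x∉ ∷ ue)) , c1 , c2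
    where
    y∉ : y ∉ (x ∷ endpoints E)
    y∉ (here e) = ne (sym e)
    y∉ (there m) = y∉V (s1 y m)
    x∉ : x ∉ endpoints E
    x∉ m = x∉V (s1 x m)
    c1 : ∀ z → z ∈ (y ∷ x ∷ endpoints E) → z ∈ (x ∷ y ∷ V)
    c1 z (here e) = there (here e)
    c1 z (there (here e)) = here e
    c1 z (there (there m)) = there (there (s1 z m))
    c2 : ∀ z → z ∈ (x ∷ y ∷ V) → z ∈ (y ∷ x ∷ endpoints E)
    c2 z (here e) = there (here e)
    c2 z (there (here e)) = here e
    c2 z (there (there m)) = there (there (s2 z m))

  orient : (M : Matching) → (∀ x → Matched M x) → (k : ℕ) (V : List (Fin n)) → length V ≤ k → Unique V →
    (∀ z → z ∈ V → σ M z ∈ V) → MatchingOn V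
  orient M all-matched k [] _ _ _ = [] , [] , [] , (λ z ()) , (λ z ())
  orient M all-matched zero (x ∷ V) () _ _
  orient M all-matched (suc k) (x ∷ V) (s≤s len) (x∉V ∷ uV) closed =
    MatchingOn-resp (f , g) (cons-edge x y V' x≢y (ed M x (all-matched x)) x∉V' y∉V' rest)
    where
    y : Fin n
    y = σ M x
    x≢y : x ≢ y
    x≢y e = all-matched x (sym e)
    y∈V : y ∈ V
    y∈V with closed x (here refl)
    ... | here e = ⊥-elim (all-matched x e)
    ... | there m = m
    V' : List (Fin n)
    V' = filter (λ z → ¬? (z ≟ y)) V
    x∉V' : x ∉ V'
    x∉V' m = All¬⇒¬Any x∉V (proj₁ (∈-filter⁻ (λ z → ¬? (z ≟ y)) {xs = V} m))
    y∉V' : y ∉ V'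
    y∉V' m = proj₂ (∈-filter⁻ (λ z → ¬? (z ≟ y)) {xs = V} m) refl
    closed' : ∀ z → z ∈ V' → σ M z ∈ V'
    closed' z m with ∈-filter⁻ (λ z → ¬? (z ≟ y)) {xs = V} m
    ... | z∈V , z≢y with closed z (there z∈V)
    ... | here e = ⊥-elim (z≢y (trans (sym (inv M z)) (cong (σ M) e)))
    ... | there m' = ∈-filter⁺ (λ z → ¬? (z ≟ y)) m' (λ e → All¬⇒¬Any x∉V (subst (_∈ V) (σ-inj M e) z∈V))
    rest : MatchingOn V'
    rest = orient M all-matched k V' (≤-trans (length-filter (λ z → ¬? (z ≟ y)) V) len)
             (filter⁺ (λ z → ¬? (z ≟ y)) {xs = V} uV) closed'
    f : ∀ z → z ∈ (x ∷ y ∷ V') → z ∈ (x ∷ V)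
    f z (here e) = here e
    f z (there (here refl)) = there y∈V
    f z (there (there m)) = there (proj₁ (∈-filter⁻ (λ z → ¬? (z ≟ y)) {xs = V} m))
    g : ∀ z → z ∈ (x ∷ V) → z ∈ (x ∷ y ∷ V')
    g z (here e) = here e
    g z (there m) with z ≟ y
    ... | yes e = there (here e)
    ... | no ne = there (there (∈-filter⁺ (λ z → ¬? (z ≟ y)) m ne))

  perfect : (M : Matching) → (∀ x → Matched M x) → PerfectMatching G
  perfect M all-matched
    with orient M all-matched n (allFin n) (≤-reflexive (length-tabulate (λ i → i))) (allFin⁺ n) (λ z _ → ∈-allFin (σ M z))
  ... | E , ae , ue , _ , covers = record
    { edges = E ; areEdges = ae ; disjoint = ue ; covering = λ v → covers v (∈-allFin v) }


module EdgeCounts {n : ℕ} (G : Digraph n) where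

  open import Data.Nat using (_+_; _*_; _≤_; z≤n; s≤s)
  open import Data.Nat.Properties
  open import Data.Bool using (Bool; true; false; _∧_; _∨_; not)
  open import Data.Fin using (Fin)
  open import Data.Product using (Σ; _×_; _,_)
  open import Relation.Binary.PropositionalEquality
  open FinSums

  edgesP : (Fin n → Bool) → ℕ
  edgesP S = sumFin n (λ x → sumFin n (λ y → 𝟙 (S x ∧ S y ∧ adj G x y)))

  crossP : (Fin n → Bool) → ℕ
  crossP A = sumFin n (λ x → sumFin n (λ y → 𝟙 (((A x ∧ not (A y)) ∨ (not (A x) ∧ A y)) ∧ adj G x y)))

  pairCount : ∀ (a b c d : Fin n → Bool) →
    sumFin n (λ x → sumFin n (λ y → 𝟙 (a x) * 𝟙 (b y) + 𝟙 (c x) * 𝟙 (d y)))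
      ≡ Σ𝟙 n a * Σ𝟙 n b + Σ𝟙 n c * Σ𝟙 n d
  pairCount a b c d = trans (dsum-+ n _ _)
    (cong₂ _+_ (sumFin-prod n (λ x → 𝟙 (a x)) (λ y → 𝟙 (b y))) (sumFin-prod n (λ x → 𝟙 (c x)) (λ y → 𝟙 (d y))))

  -- An edge inside S' ⊇ S, where S has no inner edges, has an endpoint in S' ∖ S.
  pad-pointwise : ∀ mx my sx sy a → (sx ≡ true → sy ≡ true → a ≡ false) →
    (sx ≡ true → mx ≡ true) → (sy ≡ true → my ≡ true) →
    𝟙 (mx ∧ my ∧ a) ≤ 𝟙 (mx ∧ not sx) * 𝟙 my + 𝟙 mx * 𝟙 (my ∧ not sy)
  pad-pointwise false my sx sy a _ _ _ = z≤n
  pad-pointwise true false sx sy a _ _ _ = z≤n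
  pad-pointwise true true false sy a _ _ _ = ≤-trans (𝟙≤1 a) (s≤s z≤n)
  pad-pointwise true true true false a _ _ _ = 𝟙≤1 a
  pad-pointwise true true true true a no-edge _ _ rewrite no-edge refl refl = z≤n

  pad : (S : Fin n → Bool) → (∀ x y → S x ≡ true → S y ≡ true → adj G x y ≡ false) → ∀ h t →
    Σ𝟙 n S + t ≡ h → h ≤ n → Σ (Fin n → Bool) λ S' → Σ𝟙 n S' ≡ h × edgesP S' ≤ t * h + h * t
  pad S edgeless h t size h≤n
    with interpolate n S (λ _ → true) (λ _ _ → refl) h (subst (Σ𝟙 n S ≤_) size (m≤m+n _ t))
                     (subst (h ≤_) (sym (trans (sumFin-const n 1) (*-identityʳ n))) h≤n)
  ... | S' , S⊆S' , _ , |S'| = S' , |S'| , bound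
    where
    new : Fin n → Bool
    new x = S' x ∧ not (S x)
    |new| : Σ𝟙 n new ≡ t
    |new| = +-cancelˡ-≡ (Σ𝟙 n S) _ _ (begin
      Σ𝟙 n S + Σ𝟙 n new ≡⟨ sym (sumFin-+ n _ _) ⟩
      sumFin n (λ x → 𝟙 (S x) + 𝟙 (new x)) ≡⟨ sym (sumFin-cong n (λ x → 𝟙-split (S x) (S' x) (S⊆S' x))) ⟩
      Σ𝟙 n S' ≡⟨ trans |S'| (sym size) ⟩
      Σ𝟙 n S + t ∎)
      where open ≡-Reasoning
    bound : edgesP S' ≤ t * h + h * t
    bound = begin
      edgesP S'
        ≤⟨ dsum-mono n (λ x y → pad-pointwise (S' x) (S' y) (S x) (S y) (adj G x y) (edgeless x y) (S⊆S' x) (S⊆S' y)) ⟩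
      sumFin n (λ x → sumFin n (λ y → 𝟙 (new x) * 𝟙 (S' y) + 𝟙 (S' x) * 𝟙 (new y))) ≡⟨ pairCount new S' S' new ⟩
      Σ𝟙 n new * Σ𝟙 n S' + Σ𝟙 n S' * Σ𝟙 n new ≡⟨ cong₂ (λ a b → a * b + b * a) |new| |S'| ⟩
      t * h + h * t ∎
      where open ≤-Reasoning

  -- An edge across the cut (A, Ā), where no edge joins A0 and B0, has an
  -- endpoint in A ∖ A0 or in Ā ∖ B0.
  cut-pointwise : ∀ ax ay a0x b0x a0y b0y a →
    (a0x ≡ true → b0y ≡ true → a ≡ false) → (b0x ≡ true → a0y ≡ true → a ≡ false) →
    𝟙 (((ax ∧ not ay) ∨ (not ax ∧ ay)) ∧ a) ≤
      𝟙 (ax ∧ not a0x) * 𝟙 (not ay) + 𝟙 ax * 𝟙 (not ay ∧ not b0y)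
      + (𝟙 (not ax ∧ not b0x) * 𝟙 ay + 𝟙 (not ax) * 𝟙 (ay ∧ not a0y))
  cut-pointwise true true a0x b0x a0y b0y a _ _ = z≤n
  cut-pointwise false false a0x b0x a0y b0y a _ _ = z≤n
  cut-pointwise true false false b0x a0y b0y a _ _ = ≤-trans (𝟙≤1 a) (s≤s z≤n)
  cut-pointwise true false true b0x a0y false a _ _ = ≤-trans (𝟙≤1 a) (s≤s z≤n)
  cut-pointwise true false true b0x a0y true a no-edge _ rewrite no-edge refl refl = z≤n
  cut-pointwise false true a0x false a0y b0y a _ _ = ≤-trans (𝟙≤1 a) (s≤s z≤n)
  cut-pointwise false true a0x true false b0y a _ _ = ≤-trans (𝟙≤1 a) (s≤s z≤n)
  cut-pointwise false true a0x true true b0y a _ no-edge rewrite no-edge refl refl = z≤n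

  cut-count : (A A0 B0 : Fin n → Bool) →
    (∀ x y → A0 x ≡ true → B0 y ≡ true → adj G x y ≡ false) →
    (∀ x y → B0 x ≡ true → A0 y ≡ true → adj G x y ≡ false) →
    let X1 = λ x → A x ∧ not (A0 x) ; X2 = λ x → not (A x) ∧ not (B0 x) ; Ā = λ x → not (A x) in
    crossP A ≤ (Σ𝟙 n X1 * Σ𝟙 n Ā + Σ𝟙 n A * Σ𝟙 n X2) + (Σ𝟙 n X2 * Σ𝟙 n A + Σ𝟙 n Ā * Σ𝟙 n X1)
  cut-count A A0 B0 no-AB no-BA = begin
    crossP A
      ≤⟨ dsum-mono n (λ x y → cut-pointwise (A x) (A y) (A0 x) (B0 x) (A0 y) (B0 y) (adj G x y) (no-AB x y) (no-BA x y)) ⟩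
    sumFin n (λ x → sumFin n (λ y → (𝟙 (X1 x) * 𝟙 (Ā y) + 𝟙 (A x) * 𝟙 (X2 y)) + (𝟙 (X2 x) * 𝟙 (A y) + 𝟙 (Ā x) * 𝟙 (X1 y))))
      ≡⟨ dsum-+ n _ _ ⟩
    sumFin n (λ x → sumFin n (λ y → 𝟙 (X1 x) * 𝟙 (Ā y) + 𝟙 (A x) * 𝟙 (X2 y)))
      + sumFin n (λ x → sumFin n (λ y → 𝟙 (X2 x) * 𝟙 (A y) + 𝟙 (Ā x) * 𝟙 (X1 y)))
      ≡⟨ cong₂ _+_ (pairCount X1 Ā A X2) (pairCount X2 A Ā X1) ⟩
    (Σ𝟙 n X1 * Σ𝟙 n Ā + Σ𝟙 n A * Σ𝟙 n X2) + (Σ𝟙 n X2 * Σ𝟙 n A + Σ𝟙 n Ā * Σ𝟙 n X1) ∎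
    where
    open ≤-Reasoning
    X1 X2 Ā : Fin n → Bool
    X1 x = A x ∧ not (A0 x)
    X2 x = not (A x) ∧ not (B0 x)
    Ā x = not (A x)


module Structure {n : ℕ} (G : Digraph n) where

  open import Data.Nat as N using (_+_; _*_; _∸_; _≤_; z≤n; s≤s; _≤?_)
  open import Data.Nat.Properties hiding (_≟_)
  open import Data.Bool using (Bool; true; false; _∧_; _∨_; not)
  import Data.Bool
  open import Data.Fin using (Fin; _≟_)
  open import Data.Fin.Properties using (any?)
  open import Data.Product using (Σ; _×_; _,_; proj₁; proj₂)
  open import Data.Sum using (_⊎_; inj₁; inj₂)
  open import Relation.Binary.PropositionalEquality
  open import Relation.Nullary.Decidable using (⌊_⌋)
  open import Relation.Nullary using (yes; no)
  open import Data.Empty using (⊥; ⊥-elim)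
  open import Function using (_∘_)
  open import Data.Nat.Solver using (module +-*-Solver)
  open +-*-Solver
  open FinSums
  open BoolFacts
  open Inequalities
  open Matchings G
  open EdgeCounts G

  Outcome : ℕ → ℕ → ℕ → Set
  Outcome P Q h = (Σ (Fin n → Bool) λ S → Q * edgesP S ≤ 6 * P * (n * n) × h ≤ Σ𝟙 n S)
                ⊎ (Σ (Fin n → Bool) λ A → Σ𝟙 n A ≡ h × Q * crossP A ≤ 6 * P * (n * n))
                ⊎ PerfectMatching G

  -- Four adjacency bits a₁ = [u ~ x], a₂ = [v ~ x], b₁ = [u ~ σx],
  -- b₂ = [v ~ σx] of a matched x, where u ~ x, σx ~ v and v ~ x, σx ~ u
  -- are excluded.
  pair-weight : ∀ a1 a2 b1 b2 → a1 ∧ b2 ≡ false → a2 ∧ b1 ≡ false →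
    (𝟙 a1 + 𝟙 a2) + (𝟙 b1 + 𝟙 b2) + 𝟙 ⌊ (𝟙 a1 + 𝟙 a2) + (𝟙 b1 + 𝟙 b2) ≤? 1 ⌋ ≤ 2
  pair-weight true true true true () _
  pair-weight true true true false _ ()
  pair-weight true true false true () _
  pair-weight true true false false _ _ = ≤-refl
  pair-weight true false true true () _
  pair-weight true false true false _ _ = ≤-refl
  pair-weight true false false true () _
  pair-weight true false false false _ _ = ≤-refl
  pair-weight false true true true _ ()
  pair-weight false true true false _ ()
  pair-weight false true false true _ _ = ≤-refl
  pair-weight false true false false _ _ = ≤-refl
  pair-weight false false true true _ _ = ≤-refl
  pair-weight false false true false _ _ = ≤-refl
  pair-weight false false false true _ _ = ≤-refl
  pair-weight false false false false _ _ = s≤s z≤n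

  five-patterns : ∀ a1 a2 b1 b2 → a1 ∧ b2 ≡ false → a2 ∧ b1 ≡ false →
    a1 ∧ a2 ≡ true ⊎ b1 ∧ b2 ≡ true ⊎ a1 ∧ b1 ≡ true ⊎ a2 ∧ b2 ≡ true
    ⊎ ⌊ (𝟙 a1 + 𝟙 a2) + (𝟙 b1 + 𝟙 b2) ≤? 1 ⌋ ≡ true
  five-patterns true true _ _ _ _ = inj₁ refl
  five-patterns true false true false _ _ = inj₂ (inj₂ (inj₁ refl))
  five-patterns true false _ true () _
  five-patterns true false false false _ _ = inj₂ (inj₂ (inj₂ (inj₂ refl)))
  five-patterns false true true _ _ ()
  five-patterns false true false true _ _ = inj₂ (inj₂ (inj₂ (inj₁ refl)))
  five-patterns false true false false _ _ = inj₂ (inj₂ (inj₂ (inj₂ refl)))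
  five-patterns false false true true _ _ = inj₂ (inj₁ refl)
  five-patterns false false true false _ _ = inj₂ (inj₂ (inj₂ (inj₂ refl)))
  five-patterns false false false true _ _ = inj₂ (inj₂ (inj₂ (inj₂ refl)))
  five-patterns false false false false _ _ = inj₂ (inj₂ (inj₂ (inj₂ refl)))

  module Analysis (P Q h : ℕ) (n≡h+h : n ≡ h + h) (deg-large : ∀ x → Q * n ≤ 2 * Q * degH x + 2 * P * n)
    (M : Matching) (u v : Fin n) (fu : σ M u ≡ u) (fv : σ M v ≡ v) (u≢v : u ≢ v)
    (no-path₁ : NoPath₁ M) (no-path₃ : NoPath₃ M) (no-path₅ : NoPath₅ M u v)
    where

    s : Fin n → Fin n
    s = σ M

    adjH-sym′ : ∀ {x y} → adjH x y ≡ true → adjH y x ≡ true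
    adjH-sym′ {x} {y} e = trans (adjH-sym y x) e

    free paired : Fin n → Bool
    free x = ⌊ s x ≟ x ⌋
    paired x = not (free x)

    free⇒fixed : ∀ {x} → free x ≡ true → s x ≡ x
    free⇒fixed = ≟⇒≡

    ¬free⇒matched : ∀ {x} → free x ≡ false → Matched M x
    ¬free⇒matched {x} e with s x ≟ x
    ¬free⇒matched {x} () | yes p
    ... | no ne = ne

    matched⇒¬free : ∀ {x} → Matched M x → free x ≡ false
    matched⇒¬free {x} mx with s x ≟ x
    ... | yes e = ⊥-elim (mx e)
    ... | no _ = refl

    free-σ : ∀ x → free (s x) ≡ free x
    free-σ x with s x ≟ x | s (s x) ≟ s x
    ... | yes _ | yes _ = refl
    ... | yes e | no ne = ⊥-elim (ne (trans (inv M x) (sym e)))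
    ... | no ne | yes e = ⊥-elim (ne (sym (trans (sym (inv M x)) e)))
    ... | no _ | no _ = refl

    paired-el : ∀ {x} {b : Bool} → paired x ∧ b ≡ true → Matched M x × b ≡ true
    paired-el {x} e with true-or-false (free x)
    ... | inj₁ t = ⊥-elim (t≢f {paired x ∧ _} e (cong (λ z → not z ∧ _) t))
    ... | inj₂ f = ¬free⇒matched f , proj₂ (∧-el {paired x} e)

    paired-in : ∀ {x} {b : Bool} → Matched M x → b ≡ true → paired x ∧ b ≡ true
    paired-in {x} mx e = ∧-in (cong not (matched⇒¬free mx)) e

    au av : Fin n → Bool
    au x = adjH u x
    av x = adjH v x

    -- No path of length 1: free vertices are pairwise non-adjacent.
    free-nonadj : ∀ {w x} → s w ≡ w → s x ≡ x → adjH w x ≡ false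
    free-nonadj {w} {x} fw fx with w ≟ x
    ... | yes refl = adjH-irr w
    ... | no ne = ¬t⇒f (no-path₁ w x fw fx ne)

    -- No path of length 3: no matched edge x σx with u ~ x and σx ~ v.
    no-u-σv : ∀ {x} → Matched M x → au x ∧ av (s x) ≡ false
    no-u-σv {x} mx = ¬t⇒f λ e → let (a , b) = ∧-el e in no-path₃ u x v fu fv u≢v mx a (adjH-sym′ b)

    no-v-σu : ∀ {x} → Matched M x → av x ∧ au (s x) ≡ false
    no-v-σu {x} mx = ¬t⇒f λ e → let (a , b) = ∧-el e in no-path₃ v x u fv fu (sym≢ u≢v) mx a (adjH-sym′ b)

    weight : Fin n → ℕ
    weight x = 𝟙 (au x) + 𝟙 (av x)

    hub hubMate uPair vPair low : Fin n → Bool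
    hub x = paired x ∧ (au x ∧ av x)
    hubMate x = paired x ∧ (au (s x) ∧ av (s x))
    uPair x = paired x ∧ (au x ∧ au (s x))
    vPair x = paired x ∧ (av x ∧ av (s x))
    low x = paired x ∧ ⌊ weight x + weight (s x) ≤? 1 ⌋

    hubMate≡hub∘σ : ∀ x → hubMate x ≡ hub (s x)
    hubMate≡hub∘σ x = cong (λ z → not z ∧ (au (s x) ∧ av (s x))) (sym (free-σ x))

    data Class (x : Fin n) : Set where
      freeC    : s x ≡ x → Class x
      hubC     : Matched M x → au x ≡ true → av x ≡ true → Class x
      hubMateC : Matched M x → au (s x) ≡ true → av (s x) ≡ true → Class x
      uPairC   : Matched M x → au x ≡ true → au (s x) ≡ true → Class x
      vPairC   : Matched M x → av x ≡ true → av (s x) ≡ true → Class x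
      lowC     : low x ≡ true → Class x

    classify : ∀ x → Class x
    classify x with s x ≟ x
    ... | yes fx = freeC fx
    ... | no mx with five-patterns (au x) (av x) (au (s x)) (av (s x)) (no-u-σv mx) (no-v-σu mx)
    ...   | inj₁ e = let (a , b) = ∧-el e in hubC mx a b
    ...   | inj₂ (inj₁ e) = let (a , b) = ∧-el e in hubMateC mx a b
    ...   | inj₂ (inj₂ (inj₁ e)) = let (a , b) = ∧-el e in uPairC mx a b
    ...   | inj₂ (inj₂ (inj₂ (inj₁ e))) = let (a , b) = ∧-el e in vPairC mx a b
    ...   | inj₂ (inj₂ (inj₂ (inj₂ e))) = lowC (paired-in mx e)

    U L H : ℕ
    U = Σ𝟙 n free
    L = Σ𝟙 n low
    H = Σ𝟙 n hub

    -- Counting edges from {u, v}: a matched pair contributes at most 2, a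
    -- low pair at most 1, free vertices nothing.
    degree-sum-bound : 2 * (degH u + degH v) + L + 2 * U ≤ 2 * n
    degree-sum-bound = begin
      2 * (du + dv) + L + 2 * U
        ≡⟨ cong (λ z → z + L + 2 * U) (solve 1 (λ a → con 2 :* a := a :+ a) refl (du + dv)) ⟩
      (du + dv) + (du + dv) + L + 2 * U
        ≡⟨ cong (λ z → z + L + 2 * U) (cong₂ _+_ (sym Σweight) (trans (sym Σweight) (sym (sumFin-invol n s (inv M) weight)))) ⟩
      sumFin n weight + sumFin n (weight ∘ s) + L + 2 * U
        ≡⟨ cong (_+ 2 * U) (trans (cong (_+ L) (sym (sumFin-+ n weight (weight ∘ s)))) (sym (sumFin-+ n _ _))) ⟩
      sumFin n (λ x → weight x + weight (s x) + 𝟙 (low x)) + 2 * U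
        ≤⟨ +-monoˡ-≤ (2 * U) (sumFin-mono n pointwise) ⟩
      sumFin n (λ x → 2 * 𝟙 (paired x)) + 2 * U ≡⟨ cong (_+ 2 * U) (sumFin-*ˡ n 2 _) ⟩
      2 * Σ𝟙 n paired + 2 * U
        ≡⟨ solve 2 (λ a b → con 2 :* a :+ con 2 :* b := con 2 :* (b :+ a)) refl (Σ𝟙 n paired) U ⟩
      2 * (U + Σ𝟙 n paired) ≡⟨ cong (2 *_) (Σ𝟙-compl n free) ⟩
      2 * n ∎
      where
      open ≤-Reasoning
      du dv : ℕ
      du = degH u
      dv = degH v
      Σweight : sumFin n weight ≡ du + dv
      Σweight = sumFin-+ n (λ x → 𝟙 (au x)) (λ x → 𝟙 (av x))
      pointwise : ∀ x → weight x + weight (s x) + 𝟙 (low x) ≤ 2 * 𝟙 (paired x)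
      pointwise x with free x in e
      ... | true rewrite free⇒fixed e | free-nonadj {u} {x} fu (free⇒fixed e) | free-nonadj {v} {x} fv (free⇒fixed e) = z≤n
      ... | false = pair-weight (au x) (av x) (au (s x)) (av (s x)) (no-u-σv (¬free⇒matched e)) (no-v-σu (¬free⇒matched e))

    few-free-low : 2 * Q * U + Q * L ≤ 4 * P * n
    few-free-low = few-unmatched-and-low {Q} {P} {n} {degH u + degH v} {degH u} {degH v} {L} {U} degree-sum-bound (deg-large u) (deg-large v) refl

    few-low : Q * L ≤ 4 * P * n
    few-low = ≤-trans (m≤n+m (Q * L) (2 * Q * U)) few-free-low

    deficit-via : (c : Fin n → Bool) (w : Fin n) → (∀ y → adjH w y ≡ true → c y ≡ true ⊎ low y ≡ true) →
      ∀ X → h ≡ Σ𝟙 n c + X → Q * X ≤ 6 * P * n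
    deficit-via c w nbrs X split = deficit-bound {Q} {P} {n} {Σ𝟙 n c} {L} {h} {X} few-low deg n≡h+h split
      where
      pointwise : ∀ y → 𝟙 (adjH w y) ≤ 𝟙 (c y) + 𝟙 (low y)
      pointwise y with adjH w y in e
      ... | false = z≤n
      ... | true with nbrs y e
      ...   | inj₁ cy rewrite cy = s≤s z≤n
      ...   | inj₂ ly rewrite ly = m≤n+m 1 (𝟙 (c y))
      deg : Q * n ≤ 2 * Q * (Σ𝟙 n c + L) + 2 * P * n
      deg = ≤-trans (deg-large w)
        (+-monoˡ-≤ (2 * P * n) (*-monoʳ-≤ (2 * Q) (≤-trans (sumFin-mono n pointwise) (≤-reflexive (sumFin-+ n _ _)))))

    h≤n : h ≤ n
    h≤n = subst (h ≤_) (sym n≡h+h) (m≤m+n h h)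

    edgeless-outcome : (S : Fin n → Bool) → (∀ x y → S x ≡ true → S y ≡ true → adj G x y ≡ false) →
      (∀ t → Σ𝟙 n S + t ≡ h → Q * t ≤ 6 * P * n) → Outcome P Q h
    edgeless-outcome S edgeless deficit with h ≤? Σ𝟙 n S
    ... | yes large = inj₁ (S , subst (λ e → Q * e ≤ 6 * P * (n * n)) (sym no-edges) (≤-trans (≤-reflexive (*-zeroʳ Q)) z≤n) , large)
      where
      pointwise : ∀ x y → 𝟙 (S x ∧ S y ∧ adj G x y) ≡ 0
      pointwise x y with S x in ex | S y in ey
      ... | false | _ = refl
      ... | true | false = refl
      ... | true | true rewrite edgeless x y ex ey = refl
      no-edges : edgesP S ≡ 0
      no-edges = trans (sumFin-cong n (λ x → trans (sumFin-cong n (pointwise x)) (sumFin-0 n))) (sumFin-0 n)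
    ... | no small with pad S edgeless h (h ∸ Σ𝟙 n S) (m+[n∸m]≡n (<⇒≤ (≰⇒> small))) h≤n
    ...   | S' , |S'| , edges = inj₁ (S' ,
             ≤-trans (*-monoʳ-≤ Q edges) (padding-bound {Q} {P} {n} {h} {h ∸ Σ𝟙 n S} n≡h+h (deficit _ (m+[n∸m]≡n (<⇒≤ (≰⇒> small))))) ,
             ≤-reflexive (sym |S'|))

    compl-size : (A : Fin n → Bool) → Σ𝟙 n A ≡ h → Σ𝟙 n (λ x → not (A x)) ≡ h
    compl-size A |A| = +-cancelˡ-≡ h _ _ (trans (cong (_+ Σ𝟙 n (λ x → not (A x))) (sym |A|)) (trans (Σ𝟙-compl n A) n≡h+h))

    cut-outcome : (A0 B0 : Fin n → Bool) →
      (∀ x y → A0 x ≡ true → B0 y ≡ true → adj G x y ≡ false) →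
      (∀ x y → B0 x ≡ true → A0 y ≡ true → adj G x y ≡ false) →
      (A : Fin n → Bool) → Σ𝟙 n A ≡ h →
      Q * (Σ𝟙 n (λ x → A x ∧ not (A0 x)) + Σ𝟙 n (λ x → not (A x) ∧ not (B0 x))) ≤ 6 * P * n → Outcome P Q h
    cut-outcome A0 B0 no-AB no-BA A |A| few-missing =
      inj₂ (inj₁ (A , |A| , ≤-trans (*-monoʳ-≤ Q cut) (cut-bound {Q} {P} {n} {h} {X1} {X2} n≡h+h few-missing)))
      where
      X1 X2 : ℕ
      X1 = Σ𝟙 n (λ x → A x ∧ not (A0 x))
      X2 = Σ𝟙 n (λ x → not (A x) ∧ not (B0 x))
      cut : crossP A ≤ (X1 * h + h * X2) + (X2 * h + h * X1)
      cut = subst₂ (λ a b → crossP A ≤ (X1 * b + a * X2) + (X2 * a + b * X1)) |A| (compl-size A |A|)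
              (cut-count A A0 B0 no-AB no-BA)

    hubMate-el : ∀ {b} → hubMate b ≡ true → Matched M b × au (s b) ≡ true × av (s b) ≡ true
    hubMate-el {b} e = let (mb , e') = paired-el {b} e in mb , ∧-el e'

    -- A hub mate b has no free neighbour y: u ~ σb, b ~ y (or, if y = u,
    -- v ~ σb, b ~ u) would be an augmenting 3-path.
    hubMate-free-nonadj : ∀ {b y} → hubMate b ≡ true → s y ≡ y → adjH b y ≡ false
    hubMate-free-nonadj {b} {y} hb fy = ¬t⇒f go
      where
      go : adjH b y ≡ true → ⊥
      go e with hubMate-el hb | y ≟ u
      ... | mb , ub , vb | yes refl =
        no-path₃ v (s b) u fv fu (sym≢ u≢v) (matched-σ M mb) vb (subst (λ z → adjH z u ≡ true) (sym (inv M b)) e)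
      ... | mb , ub , vb | no y≢u =
        no-path₃ u (s b) y fu fy (sym≢ y≢u) (matched-σ M mb) ub (subst (λ z → adjH z y ≡ true) (sym (inv M b)) e)

    -- Two hub mates x, y are non-adjacent: u ~ σx, x ~ y, σy ~ v is a 5-path.
    hubMate-nonadj : ∀ {x y} → hubMate x ≡ true → hubMate y ≡ true → adjH x y ≡ false
    hubMate-nonadj {x} {y} hx hy = ¬t⇒f go
      where
      go : adjH x y ≡ true → ⊥
      go e with hubMate-el hx | hubMate-el hy
      ... | mx , ux , vx | my , uy , vy =
        no-path₅ (s x) y (matched-σ M mx) my y≢σx y≢σσx ux (subst (λ z → adjH z y ≡ true) (sym (inv M x)) e) (adjH-sym′ vy)
        where
        y≢σx : y ≢ s x
        y≢σx q = t≢f (∧-in (subst (λ z → au z ≡ true) (trans (cong s q) (inv M x)) uy) vx) (no-u-σv mx)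
        y≢σσx : y ≢ s (s x)
        y≢σσx q = t≢f (subst (λ z → adjH x z ≡ true) (trans q (inv M x)) e) (adjH-irr x)

    indep : Fin n → Bool
    indep x = hubMate x ∨ free x

    indep-nonadj : ∀ x y → indep x ≡ true → indep y ≡ true → adj G x y ≡ false
    indep-nonadj x y ix iy = ¬adjH⇒¬adj (nonadjH (∨-el {hubMate x} ix) (∨-el {hubMate y} iy))
      where
      nonadjH : hubMate x ≡ true ⊎ free x ≡ true → hubMate y ≡ true ⊎ free y ≡ true → adjH x y ≡ false
      nonadjH (inj₁ hx) (inj₁ hy) = hubMate-nonadj hx hy
      nonadjH (inj₁ hx) (inj₂ fy) = hubMate-free-nonadj hx (free⇒fixed fy)
      nonadjH (inj₂ fx) (inj₁ hy) = trans (adjH-sym x y) (hubMate-free-nonadj hy (free⇒fixed fx))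
      nonadjH (inj₂ fx) (inj₂ fy) = free-nonadj (free⇒fixed fx) (free⇒fixed fy)

    -- σ maps hubs onto hub mates, so |indep| = H + U.
    #indep : Σ𝟙 n indep ≡ H + U
    #indep = begin
      Σ𝟙 n indep                                   ≡⟨ sumFin-cong n split ⟩
      sumFin n (λ x → 𝟙 (hubMate x) + 𝟙 (free x)) ≡⟨ sumFin-+ n _ _ ⟩
      Σ𝟙 n hubMate + U                             ≡⟨ cong (_+ U) #hubMate ⟩
      H + U                                        ∎
      where
      open ≡-Reasoning
      𝟙∨false : ∀ b → 𝟙 (b ∨ false) ≡ 𝟙 b + 0
      𝟙∨false true = refl
      𝟙∨false false = refl
      split : ∀ x → 𝟙 (indep x) ≡ 𝟙 (hubMate x) + 𝟙 (free x)
      split x with free x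
      ... | true = refl
      ... | false = 𝟙∨false _
      #hubMate : Σ𝟙 n hubMate ≡ H
      #hubMate = trans (sumFin-cong n (λ x → cong 𝟙 (hubMate≡hub∘σ x))) (sumFin-invol n s (inv M) (λ x → 𝟙 (hub x)))

    -- A hub mate b sees only hubs and low vertices (anything else closes an
    -- augmenting path through b and its hub σb).
    hubMate-nbrs : ∀ {b} → hubMate b ≡ true → ∀ y → adjH b y ≡ true → hub y ≡ true ⊎ low y ≡ true
    hubMate-nbrs {b} hb y b~y with hubMate-el hb | classify y
    ... | _ | freeC fy = ⊥-elim (t≢f b~y (hubMate-free-nonadj hb fy))
    ... | _ | hubC my a c = inj₁ (paired-in my (∧-in a c))
    ... | _ | hubMateC my a c = ⊥-elim (t≢f b~y (hubMate-nonadj hb (paired-in my (∧-in a c))))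
    ... | _ | lowC ly = inj₂ ly
    ... | mb , ub , vb | uPairC my uy usy =
      ⊥-elim (no-path₅ (s y) b (matched-σ M my) mb b≢σy b≢σσy usy
                (subst (λ z → adjH z b ≡ true) (sym (inv M y)) (adjH-sym′ b~y)) (adjH-sym′ vb))
      where
      b≢σy : b ≢ s y
      b≢σy q = t≢f (∧-in vb (subst (λ z → au z ≡ true) (trans (sym q) (sym (inv M b))) usy)) (no-v-σu (matched-σ M mb))
      b≢σσy : b ≢ s (s y)
      b≢σσy q = t≢f (subst (λ z → adjH b z ≡ true) (sym (trans q (inv M y))) b~y) (adjH-irr b)
    ... | mb , ub , vb | vPairC my vy vsy =
      ⊥-elim (no-path₅ (s b) y (matched-σ M mb) my y≢σb y≢σσb ub
                (subst (λ z → adjH z y ≡ true) (sym (inv M b)) b~y) (adjH-sym′ vsy))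
      where
      y≢σb : y ≢ s b
      y≢σb q = t≢f (∧-in ub (subst (λ z → av (s z) ≡ true) q vsy)) (no-u-σv (matched-σ M mb))
      y≢σσb : y ≢ s (s b)
      y≢σσb q = t≢f (subst (λ z → adjH b z ≡ true) (trans q (inv M b)) b~y) (adjH-irr b)

    -- If there is a hub x, its mate σx has degree ≤ H + L, so the edgeless
    -- set indep of size H + U falls short of h by at most 6γn.
    hubCase : ∀ x → hub x ≡ true → Outcome P Q h
    hubCase x hx = edgeless-outcome indep indep-nonadj deficit
      where
      mate : hubMate (s x) ≡ true
      mate = trans (hubMate≡hub∘σ (s x)) (subst (λ z → hub z ≡ true) (sym (inv M x)) hx)
      deficit : ∀ t → Σ𝟙 n indep + t ≡ h → Q * t ≤ 6 * P * n
      deficit t size = ≤-trans (*-monoʳ-≤ Q (m≤n+m t U))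
        (deficit-via hub (s x) (hubMate-nbrs mate) (U + t) (trans (sym size) (trans (cong (_+ t) #indep) (+-assoc H U t))))

    -- Without hubs, u-pairs and v-pairs are separated: the u-side
    -- A0 = u-pairs ∪ {u} and the v-side B0 = v-pairs ∪ {v} span no edge.
    module NoHub (no-hub : ∀ x → hub x ≡ false) where

      not-hub : ∀ {x} → Matched M x → au x ≡ true → av x ≡ true → ⊥
      not-hub {x} mx a b = t≢f (paired-in mx (∧-in a b)) (no-hub x)

      uPair-el : ∀ {x} → uPair x ≡ true → Matched M x × au x ≡ true × au (s x) ≡ true
      uPair-el {x} e = let (mx , e') = paired-el {x} e in mx , ∧-el e'

      vPair-el : ∀ {x} → vPair x ≡ true → Matched M x × av x ≡ true × av (s x) ≡ true
      vPair-el {x} e = let (mx , e') = paired-el {x} e in mx , ∧-el e'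

      data Side (x : Fin n) : Set where
        freeS  : s x ≡ x → Side x
        uPairS : uPair x ≡ true → Side x
        vPairS : vPair x ≡ true → Side x
        lowS   : low x ≡ true → Side x

      side : ∀ x → Side x
      side x with classify x
      ... | freeC fx = freeS fx
      ... | hubC mx a b = ⊥-elim (not-hub mx a b)
      ... | hubMateC mx a b = ⊥-elim (not-hub (matched-σ M mx) a b)
      ... | uPairC mx a b = uPairS (paired-in mx (∧-in a b))
      ... | vPairC mx a b = vPairS (paired-in mx (∧-in a b))
      ... | lowC l = lowS l

      -- A u-pair x and a v-pair y are non-adjacent: u ~ σx, x ~ y, σy ~ v.
      uPair-vPair-nonadj : ∀ {x y} → uPair x ≡ true → vPair y ≡ true → adjH x y ≡ false
      uPair-vPair-nonadj {x} {y} ux vy with uPair-el ux | vPair-el vy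
      ... | mx , a , b | my , c , d = ¬t⇒f λ e →
        no-path₅ (s x) y (matched-σ M mx) my y≢σx y≢σσx b (subst (λ z → adjH z y ≡ true) (sym (inv M x)) e) (adjH-sym′ d)
        where
        y≢σx : y ≢ s x
        y≢σx q = not-hub mx a (subst (λ z → av z ≡ true) (trans (cong s q) (inv M x)) d)
        y≢σσx : y ≢ s (s x)
        y≢σσx q = not-hub mx a (subst (λ z → av z ≡ true) (trans q (inv M x)) c)

      A0 B0 : Fin n → Bool
      A0 x = uPair x ∨ ⌊ x ≟ u ⌋
      B0 x = vPair x ∨ ⌊ x ≟ v ⌋

      A0-B0-nonadjH : ∀ x y → A0 x ≡ true → B0 y ≡ true → adjH x y ≡ false
      A0-B0-nonadjH x y ax by with ∨-el {uPair x} ax | ∨-el {vPair y} by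
      ... | inj₁ ux | inj₁ vy = uPair-vPair-nonadj ux vy
      ... | inj₁ ux | inj₂ y≟v with ≟⇒≡ y≟v
      ...   | refl = ¬t⇒f λ e → let (mx , a , _) = uPair-el ux in not-hub mx a (adjH-sym′ e)
      A0-B0-nonadjH x y ax by | inj₂ x≟u | inj₁ vy with ≟⇒≡ x≟u
      ...   | refl = ¬t⇒f λ e → let (my , c , _) = vPair-el vy in not-hub my e c
      A0-B0-nonadjH x y ax by | inj₂ x≟u | inj₂ y≟v with ≟⇒≡ x≟u | ≟⇒≡ y≟v
      ...   | refl | refl = ¬t⇒f (no-path₁ u v fu fv u≢v)

      A0-B0-nonadj : ∀ x y → A0 x ≡ true → B0 y ≡ true → adj G x y ≡ false
      A0-B0-nonadj x y a b = ¬adjH⇒¬adj (A0-B0-nonadjH x y a b)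

      B0-A0-nonadj : ∀ x y → B0 x ≡ true → A0 y ≡ true → adj G x y ≡ false
      B0-A0-nonadj x y b a = ¬adjH⇒¬adj (trans (adjH-sym x y) (A0-B0-nonadjH y x a b))

      A0-B0-disjoint : ∀ x → A0 x ≡ true → B0 x ≡ true → ⊥
      A0-B0-disjoint x a b with ∨-el {uPair x} a | ∨-el {vPair x} b
      ... | inj₁ ux | inj₁ vx = let (mx , a' , _) = uPair-el ux ; (_ , c , _) = vPair-el vx in not-hub mx a' c
      ... | inj₁ ux | inj₂ x≟v = proj₁ (uPair-el ux) (subst (λ z → s z ≡ z) (sym (≟⇒≡ x≟v)) fv)
      ... | inj₂ x≟u | inj₁ vx = proj₁ (vPair-el vx) (subst (λ z → s z ≡ z) (sym (≟⇒≡ x≟u)) fu)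
      ... | inj₂ x≟u | inj₂ x≟v = u≢v (trans (sym (≟⇒≡ x≟u)) (≟⇒≡ x≟v))

      uPair-nbrs : ∀ {x} → uPair x ≡ true → ∀ y → adjH x y ≡ true → A0 y ≡ true ⊎ low y ≡ true
      uPair-nbrs {x} ux y x~y with side y
      ... | uPairS uy = inj₁ (∨-inl _ uy)
      ... | vPairS vy = ⊥-elim (t≢f x~y (uPair-vPair-nonadj ux vy))
      ... | lowS ly = inj₂ ly
      ... | freeS fy with y ≟ u
      ...   | yes y≡u = inj₁ (∨-inr (uPair y) refl)
      ...   | no y≢u = let (mx , _ , b) = uPair-el ux in
        ⊥-elim (no-path₃ y x u fy fu y≢u mx (adjH-sym′ x~y) (adjH-sym′ b))

      vPair-nbrs : ∀ {x} → vPair x ≡ true → ∀ y → adjH x y ≡ true → B0 y ≡ true ⊎ low y ≡ true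
      vPair-nbrs {x} vx y x~y with side y
      ... | vPairS vy = inj₁ (∨-inl _ vy)
      ... | uPairS uy = ⊥-elim (t≢f (adjH-sym′ x~y) (uPair-vPair-nonadj uy vx))
      ... | lowS ly = inj₂ ly
      ... | freeS fy with y ≟ v
      ...   | yes y≡v = inj₁ (∨-inr (vPair y) refl)
      ...   | no y≢v = let (mx , _ , b) = vPair-el vx in
        ⊥-elim (no-path₃ y x v fy fv y≢v mx (adjH-sym′ x~y) (adjH-sym′ b))

      u-nbrs : (∀ x → uPair x ≡ false) → ∀ y → adjH u y ≡ true → false ≡ true ⊎ low y ≡ true
      u-nbrs no-uPair y u~y with side y
      ... | freeS fy = ⊥-elim (t≢f u~y (free-nonadj fu fy))
      ... | uPairS uy = ⊥-elim (t≢f uy (no-uPair y))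
      ... | vPairS vy = let (my , c , _) = vPair-el vy in ⊥-elim (not-hub my u~y c)
      ... | lowS ly = inj₂ ly

      v-nbrs : (∀ x → vPair x ≡ false) → ∀ y → adjH v y ≡ true → false ≡ true ⊎ low y ≡ true
      v-nbrs no-vPair y v~y with side y
      ... | freeS fy = ⊥-elim (t≢f v~y (free-nonadj fv fy))
      ... | vPairS vy = ⊥-elim (t≢f vy (no-vPair y))
      ... | uPairS uy = let (my , a , _) = uPair-el uy in ⊥-elim (not-hub my a v~y)
      ... | lowS ly = inj₂ ly

      -- If u (or v) sees only low vertices then h ≤ 6γn, and the empty set
      -- padded to size h is 6γ-independent.
      one-side-empty : (w : Fin n) → (∀ y → adjH w y ≡ true → false ≡ true ⊎ low y ≡ true) → Outcome P Q h
      one-side-empty w nbrs = edgeless-outcome (λ _ → false) (λ x y ()) deficit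
        where
        deficit : ∀ t → Σ𝟙 n (λ _ → false) + t ≡ h → Q * t ≤ 6 * P * n
        deficit t size = deficit-via (λ _ → false) w nbrs t (sym size)

      -- A large u-side: take A ⊆ A0 of size h.  Its complement contains B0,
      -- and the degree of a v-pair bounds how much of it lies outside B0.
      u-side-large : h N.< Σ𝟙 n A0 → ∀ y → vPair y ≡ true → Outcome P Q h
      u-side-large large y vy
        with interpolate n (λ _ → false) A0 (λ x ()) h (subst (_≤ h) (sym (sumFin-0 n)) z≤n) (<⇒≤ large)
      ... | A , _ , A⊆A0 , |A| =
        cut-outcome A0 B0 A0-B0-nonadj B0-A0-nonadj A |A| (subst (λ z → Q * (z + X2) ≤ 6 * P * n) (sym X1≡0) QX2)
        where
        X2 : ℕ
        X2 = Σ𝟙 n (λ x → not (A x) ∧ not (B0 x))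
        X1≡0 : Σ𝟙 n (λ x → A x ∧ not (A0 x)) ≡ 0
        X1≡0 = trans (sumFin-cong n pointwise) (sumFin-0 n)
          where
          pointwise : ∀ x → 𝟙 (A x ∧ not (A0 x)) ≡ 0
          pointwise x with true-or-false (A x)
          ... | inj₁ ax rewrite ax | A⊆A0 x ax = refl
          ... | inj₂ ax rewrite ax = refl
        B0⊆Ā : ∀ x → B0 x ≡ true → not (A x) ≡ true
        B0⊆Ā x bx with true-or-false (A x)
        ... | inj₁ ax = ⊥-elim (A0-B0-disjoint x (A⊆A0 x ax) bx)
        ... | inj₂ ax rewrite ax = refl
        h≡B0+X2 : h ≡ Σ𝟙 n B0 + X2
        h≡B0+X2 = trans (sym (compl-size A |A|))
          (trans (sumFin-cong n (λ x → 𝟙-split (B0 x) (not (A x)) (B0⊆Ā x))) (sumFin-+ n _ _))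
        QX2 : Q * X2 ≤ 6 * P * n
        QX2 = deficit-via B0 y (vPair-nbrs vy) X2 h≡B0+X2

      -- A large v-side: take A ⊇ complement of B0 of size h.
      v-side-large : h N.< Σ𝟙 n B0 → ∀ x → uPair x ≡ true → Outcome P Q h
      v-side-large large x ux
        with interpolate n (λ y → not (B0 y)) (λ _ → true) (λ _ _ → refl) h small
               (subst (h ≤_) (sym (trans (sumFin-const n 1) (*-identityʳ n))) h≤n)
        where
        small : Σ𝟙 n (λ y → not (B0 y)) ≤ h
        small = +-cancelˡ-≤ h _ _ (≤-trans (+-monoˡ-≤ _ (<⇒≤ large)) (≤-reflexive (trans (Σ𝟙-compl n B0) n≡h+h)))
      ... | A , B̄0⊆A , _ , |A| =
        cut-outcome A0 B0 A0-B0-nonadj B0-A0-nonadj A |A|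
          (subst (λ z → Q * (X1 + z) ≤ 6 * P * n) (sym X2≡0) (subst (λ z → Q * z ≤ 6 * P * n) (sym (+-identityʳ X1)) QX1))
        where
        X1 : ℕ
        X1 = Σ𝟙 n (λ y → A y ∧ not (A0 y))
        X2≡0 : Σ𝟙 n (λ y → not (A y) ∧ not (B0 y)) ≡ 0
        X2≡0 = trans (sumFin-cong n pointwise) (sumFin-0 n)
          where
          pointwise : ∀ y → 𝟙 (not (A y) ∧ not (B0 y)) ≡ 0
          pointwise y with true-or-false (B0 y)
          ... | inj₁ by rewrite by with A y
          ...   | true = refl
          ...   | false = refl
          pointwise y | inj₂ by rewrite by | B̄0⊆A y (cong not by) = refl
        A0⊆A : ∀ y → A0 y ≡ true → A y ≡ true
        A0⊆A y ay with true-or-false (B0 y)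
        ... | inj₁ by = ⊥-elim (A0-B0-disjoint y ay by)
        ... | inj₂ by = B̄0⊆A y (cong not by)
        h≡A0+X1 : h ≡ Σ𝟙 n A0 + X1
        h≡A0+X1 = trans (sym |A|) (trans (sumFin-cong n (λ y → 𝟙-split (A0 y) (A y) (A0⊆A y))) (sumFin-+ n _ _))
        QX1 : Q * X1 ≤ 6 * P * n
        QX1 = deficit-via A0 x (uPair-nbrs ux) X1 h≡A0+X1

      -- Both sides small: A0 ⊆ A ⊆ complement of B0 with |A| = h; every
      -- vertex outside A0 ∪ B0 is free or low, so X₁ + X₂ ≤ U + L.
      sides-small : Σ𝟙 n A0 ≤ h → Σ𝟙 n B0 ≤ h → Outcome P Q h
      sides-small A0-small B0-small with interpolate n A0 (λ x → not (B0 x)) A0⊆B̄0 h A0-small B̄0-large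
        where
        A0⊆B̄0 : ∀ x → A0 x ≡ true → not (B0 x) ≡ true
        A0⊆B̄0 x ax with true-or-false (B0 x)
        ... | inj₁ bx = ⊥-elim (A0-B0-disjoint x ax bx)
        ... | inj₂ bx = cong not bx
        B̄0-large : h ≤ Σ𝟙 n (λ x → not (B0 x))
        B̄0-large = +-cancelˡ-≤ h _ _ (≤-trans (≤-reflexive (sym n≡h+h))
                     (≤-trans (≤-reflexive (sym (Σ𝟙-compl n B0))) (+-monoˡ-≤ _ B0-small)))
      ... | A , A0⊆A , A⊆B̄0 , |A| = cut-outcome A0 B0 A0-B0-nonadj B0-A0-nonadj A |A| (≤-trans (*-monoʳ-≤ Q missing) QLU)
        where
        excl : ∀ a → 𝟙 (a ∧ true) + 𝟙 (not a ∧ true) ≤ 1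
        excl true = ≤-refl
        excl false = ≤-refl
        pointwise : ∀ x → 𝟙 (A x ∧ not (A0 x)) + 𝟙 (not (A x) ∧ not (B0 x)) ≤ 𝟙 (low x) + 𝟙 (free x)
        pointwise x with true-or-false (A0 x) | true-or-false (B0 x)
        ... | inj₁ ax | _ rewrite ax | A0⊆A x ax = z≤n
        ... | inj₂ _ | inj₁ bx rewrite bx | ¬t⇒f {A x} (λ a → t≢f (A⊆B̄0 x a) (cong not bx)) = z≤n
        ... | inj₂ ax | inj₂ bx rewrite ax | bx = ≤-trans (excl (A x)) (free-or-low (side x))
          where
          free-or-low : Side x → 1 ≤ 𝟙 (low x) + 𝟙 (free x)
          free-or-low (freeS fx) rewrite ≡⇒≟ fx = ≤-refl
          free-or-low (uPairS ux) = ⊥-elim (t≢f (∨-inl _ ux) ax)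
          free-or-low (vPairS vx) = ⊥-elim (t≢f (∨-inl _ vx) bx)
          free-or-low (lowS lx) rewrite lx = s≤s z≤n
        missing : Σ𝟙 n (λ x → A x ∧ not (A0 x)) + Σ𝟙 n (λ x → not (A x) ∧ not (B0 x)) ≤ L + U
        missing = subst₂ _≤_ (sumFin-+ n _ _) (sumFin-+ n _ _) (sumFin-mono n pointwise)
        QLU : Q * (L + U) ≤ 6 * P * n
        QLU = begin
          Q * (L + U)                ≡⟨ *-distribˡ-+ Q L U ⟩
          Q * L + Q * U              ≤⟨ m≤n+m _ (Q * U) ⟩
          Q * U + (Q * L + Q * U)
            ≡⟨ solve 3 (λ Q L U → Q :* U :+ (Q :* L :+ Q :* U) := con 2 :* Q :* U :+ Q :* L) refl Q L U ⟩
          2 * Q * U + Q * L          ≤⟨ few-free-low ⟩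
          4 * P * n                  ≤⟨ *-monoˡ-≤ n (*-monoˡ-≤ P {4} {6} (m≤m+n 4 2)) ⟩
          6 * P * n                  ∎
          where open ≤-Reasoning

      noHubCase : Outcome P Q h
      noHubCase with any? (λ x → uPair x Data.Bool.≟ true) | any? (λ x → vPair x Data.Bool.≟ true)
      ... | no none | _ = one-side-empty u (u-nbrs (λ x → ¬t⇒f (λ e → none (x , e))))
      ... | yes _ | no none = one-side-empty v (v-nbrs (λ x → ¬t⇒f (λ e → none (x , e))))
      ... | yes (x , ux) | yes (y , vy) with h N.<? Σ𝟙 n A0 | h N.<? Σ𝟙 n B0
      ...   | yes large | _ = u-side-large large y vy
      ...   | no _ | yes large = v-side-large large x ux
      ...   | no A0-small | no B0-small = sides-small (≮⇒≥ A0-small) (≮⇒≥ B0-small)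

    outcome : Outcome P Q h
    outcome with any? (λ x → hub x Data.Bool.≟ true)
    ... | yes (x , hx) = hubCase x hx
    ... | no none = NoHub.noHubCase (λ x → ¬t⇒f (λ e → none (x , e)))


module Algorithm {n : ℕ} (G : Digraph n) where

  open import Data.Nat as N using (suc; zero; _+_; _*_; _≤_; _<_; z≤n; s≤s)
  open import Data.Nat.Properties hiding (_≟_; <-cmp; <-irrefl; <-asym; _<?_)
  open import Data.Bool using (Bool; true; not; _∧_)
  import Data.Bool
  open import Data.Fin as F using (Fin; _≟_)
  open import Data.Fin.Properties using (any?; _<?_; <-cmp; <-irrefl; <-asym)
  open import Data.Product using (Σ; _×_; _,_; proj₁; proj₂)
  open import Data.Sum using (_⊎_; inj₁; inj₂)
  open import Relation.Binary.PropositionalEquality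
  open import Relation.Binary.Definitions using (tri<; tri≈; tri>)
  open import Relation.Nullary.Decidable using (⌊_⌋; _×-dec_)
  open import Relation.Nullary using (Dec; yes; no; ¬_; ¬?)
  open import Data.Empty using (⊥-elim)
  open import Function using (_∘_)
  open FinSums
  open BoolFacts
  open Matchings G
  open PerfectMatchings G
  open Structure G

  𝟙-yes : ∀ {A : Set} (d : Dec A) → A → 𝟙 ⌊ d ⌋ ≡ 1
  𝟙-yes (yes _) _ = refl
  𝟙-yes (no ¬a) a = ⊥-elim (¬a a)

  𝟙-no : ∀ {A : Set} (d : Dec A) → ¬ A → 𝟙 ⌊ d ⌋ ≡ 0
  𝟙-no (yes a) ¬a = ⊥-elim (¬a a)
  𝟙-no (no _) _ = refl

  -- The matched vertices come in pairs {x, σx}; counting each pair at its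
  -- smaller vertex shows that their number is even.
  parity : (M : Matching) → Σ ℕ λ m → countUnmatched M + (m + m) ≡ n
  parity M = sumFin n first , trans (cong (countUnmatched M +_) (sym pairs)) (Σ𝟙-compl n (unmatched M))
    where
    s : Fin n → Fin n
    s = σ M
    first : Fin n → ℕ
    first x = 𝟙 ⌊ x <? s x ⌋
    σ-≮ : ∀ {x} → x F.< s x → ¬ (s x F.< s (s x))
    σ-≮ {x} x<σx σx<x = <-asym x<σx (subst (s x F.<_) (inv M x) σx<x)
    pointwise : ∀ x → 𝟙 (not (unmatched M x)) ≡ first x + first (s x)
    pointwise x with <-cmp x (s x)
    ... | tri< x<σx _ _ rewrite ≢⇒≟ {x = s x} (λ e → <-irrefl (sym e) x<σx) =
      sym (cong₂ _+_ (𝟙-yes (x <? s x) x<σx) (𝟙-no (s x <? s (s x)) (σ-≮ x<σx)))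
    ... | tri≈ _ x≡σx _ rewrite ≡⇒≟ {x = s x} (sym x≡σx) =
      sym (cong₂ _+_ (𝟙-no (x <? s x) (<-irrefl x≡σx))
                     (𝟙-no (s x <? s (s x)) (<-irrefl (trans (sym x≡σx) (sym (inv M x))))))
    ... | tri> _ _ σx<x rewrite ≢⇒≟ {x = s x} (λ e → <-irrefl e σx<x) =
      sym (cong₂ _+_ (𝟙-no (x <? s x) (λ x<σx → <-asym x<σx σx<x))
                     (𝟙-yes (s x <? s (s x)) (subst (s x F.<_) (sym (inv M x)) σx<x)))
    pairs : Σ𝟙 n (λ x → not (unmatched M x)) ≡ sumFin n first + sumFin n first
    pairs = trans (sumFin-cong n pointwise)
              (trans (sumFin-+ n first (first ∘ s)) (cong (sumFin n first +_) (sumFin-invol n s (inv M) first)))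

  odd≢even : ∀ a b → suc (a + a) ≢ b + b
  odd≢even a b eq = even≢odd b a (trans (double b) (trans (sym eq) (cong suc (sym (double a)))))
    where
    double : ∀ k → 2 * k ≡ k + k
    double k = cong (k +_) (+-identityʳ k)

  second-unmatched : ∀ h → n ≡ h + h → (M : Matching) (u : Fin n) → σ M u ≡ u →
    Σ (Fin n) λ v → σ M v ≡ v × u ≢ v
  second-unmatched h n≡h+h M u fu = v , ≟⇒≡ (proj₁ v-bits) , u≢v
    where
    others : Fin n → Bool
    others x = unmatched M x ∧ not ⌊ x ≟ u ⌋
    split : countUnmatched M ≡ 1 + Σ𝟙 n others
    split = trans (sumFin-cong n (λ x → 𝟙-split ⌊ x ≟ u ⌋ (unmatched M x) (u-unmatched x)))
              (trans (sumFin-+ n _ _) (cong (_+ Σ𝟙 n others) (Σ𝟙-single n u)))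
      where
      u-unmatched : ∀ x → ⌊ x ≟ u ⌋ ≡ true → unmatched M x ≡ true
      u-unmatched x e rewrite ≟⇒≡ e = ≡⇒≟ fu
    others-pos : 0 < Σ𝟙 n others
    others-pos with Σ𝟙 n others in e | parity M
    ... | suc _ | _ = s≤s z≤n
    ... | zero | m , eq = ⊥-elim (odd≢even m h (begin
      suc (m + m)                        ≡⟨ cong (λ k → suc k + (m + m)) (sym e) ⟩
      1 + Σ𝟙 n others + (m + m)          ≡⟨ cong (_+ (m + m)) (sym split) ⟩
      countUnmatched M + (m + m)         ≡⟨ trans eq n≡h+h ⟩
      h + h                              ∎))
      where open ≡-Reasoning
    𝟙-pos : ∀ {b} → 0 < 𝟙 b → b ≡ true
    𝟙-pos {true} _ = refl
    found : Σ (Fin n) λ x → 0 < 𝟙 (others x)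
    found = sumFin-pos n (λ x → 𝟙 (others x)) others-pos
    v : Fin n
    v = proj₁ found
    v-bits : unmatched M v ≡ true × not ⌊ v ≟ u ⌋ ≡ true
    v-bits = ∧-el {unmatched M v} (𝟙-pos (proj₂ found))
    u≢v : u ≢ v
    u≢v u≡v = t≢f (proj₂ v-bits) (cong not (≡⇒≟ (sym u≡v)))

  module Run (P Q h : ℕ) (n≡h+h : n ≡ h + h) (deg-large : ∀ x → Q * n ≤ 2 * Q * degH x + 2 * P * n) where

    step : (M : Matching) → Outcome P Q h ⊎ Improvement M
    step M with any? (λ x → σ M x ≟ x)
    ... | no none = inj₁ (inj₂ (inj₂ (perfect M (λ x e → none (x , e)))))
    ... | yes (u , fu) with second-unmatched h n≡h+h M u fu
    ... | v , fv , u≢v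
      with any? (λ w → any? (λ w' → (σ M w ≟ w) ×-dec ((σ M w' ≟ w') ×-dec (¬? (w ≟ w')
                                     ×-dec (adjH w w' Data.Bool.≟ true)))))
    ... | yes (w , w' , a , b , c , d) = inj₂ (augment₁ M w w' a b c d)
    ... | no none₁
      with any? (λ w → any? (λ a → any? (λ w' → (σ M w ≟ w) ×-dec ((σ M w' ≟ w') ×-dec (¬? (w ≟ w')
                 ×-dec (¬? (σ M a ≟ a) ×-dec ((adjH w a Data.Bool.≟ true) ×-dec (adjH (σ M a) w' Data.Bool.≟ true))))))))
    ... | yes (w , a , w' , b1 , b2 , b3 , b4 , b5 , b6) = inj₂ (augment₃ M w a w' b1 b2 b3 b4 b5 b6)
    ... | no none₃
      with any? (λ a → any? (λ c → ¬? (σ M a ≟ a) ×-dec (¬? (σ M c ≟ c) ×-dec (¬? (c ≟ a) ×-dec (¬? (c ≟ σ M a)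
                 ×-dec ((adjH u a Data.Bool.≟ true) ×-dec ((adjH (σ M a) c Data.Bool.≟ true) ×-dec (adjH (σ M c) v Data.Bool.≟ true))))))))
    ... | yes (a , c , b1 , b2 , b3 , b4 , b5 , b6 , b7) = inj₂ (augment₅ M u a c v fu fv u≢v b1 b2 b3 b4 b5 b6 b7)
    ... | no none₅ = inj₁ (Analysis.outcome P Q h n≡h+h deg-large M u v fu fv u≢v
            (λ w w' a b c d → none₁ (w , w' , a , b , c , d))
            (λ w a w' b1 b2 b3 b4 b5 b6 → none₃ (w , a , w' , b1 , b2 , b3 , b4 , b5 , b6))
            (λ a c b1 b2 b3 b4 b5 b6 b7 → none₅ (a , c , b1 , b2 , b3 , b4 , b5 , b6 , b7)))

    -- Repeating `step` terminates: each improvement lowers the number of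
    -- unmatched vertices, which starts at most n.
    iterate : (k : ℕ) (M : Matching) → countUnmatched M ≤ k → Outcome P Q h
    iterate zero M bound with step M
    ... | inj₁ done = done
    ... | inj₂ (M' , fewer) = ⊥-elim (n≮0 (≤-trans fewer bound))
    iterate (suc k) M bound with step M
    ... | inj₁ done = done
    ... | inj₂ (M' , fewer) = iterate k M' (N.s≤s⁻¹ (≤-trans fewer bound))

    outcome : Outcome P Q h
    outcome = iterate n emptyMatching (Σ𝟙≤n n _)


module Translation {n : ℕ} (G : Digraph n) where

  open import Data.Nat using (suc; _+_; _*_; _≤_; _/_)
  open import Data.Nat.Properties using (≤-trans; +-monoˡ-≤; *-monoʳ-≤; *-comm; +-identityʳ; +-cancelˡ-≡)
  open import Data.Nat.DivMod using (m*n/n≡m; +-distrib-/-∣ˡ)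
  open import Data.Nat.Divisibility using (_∣_; divides)
  open import Data.Rational as Q using (ℚ; ½)
  open import Data.Bool using (not; _∧_; _∨_)
  open import Data.Fin using (Fin)
  open import Data.Fin.Subset using (Subset; ∣_∣)
  open import Data.Product using (Σ; _×_; _,_)
  open import Data.Sum using (_⊎_; inj₁; inj₂)
  open import Relation.Binary.PropositionalEquality
  open FinSums
  open RationalBridge
  open Matchings G
  open EdgeCounts G
  open Structure G

  halves : 2 ∣ n → n ≡ n / 2 + n / 2
  halves (divides k n≡k*2) = begin
    n                     ≡⟨ n≡k*2 ⟩
    k * 2                 ≡⟨ *-comm k 2 ⟩
    k + (k + 0)           ≡⟨ cong (k +_) (+-identityʳ k) ⟩
    k + k                 ≡⟨ cong₂ _+_ (sym half) (sym half) ⟩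
    n / 2 + n / 2         ∎
    where
    open ≡-Reasoning
    half : n / 2 ≡ k
    half = trans (cong (_/ 2) n≡k*2) (m*n/n≡m k 2)

  degree-large : (γ : ℚ) (p q : ℕ) → γ Q.* ι (suc q) ≡ ι (suc p) →
    ((x : Fin n) → ((½ Q.- γ) Q.* ℕ→ℚ n Q.≤ ℕ→ℚ (outdeg G x)) ⊎ ((½ Q.- γ) Q.* ℕ→ℚ n Q.≤ ℕ→ℚ (indeg G x))) →
    ∀ x → suc q * n ≤ 2 * suc q * degH x + 2 * suc p * n
  degree-large γ p q γQ≡P deg x with deg x
  ... | inj₁ out = ≤-trans (degree-condition-ℕ γ (suc p) (suc q) n (outdeg G x) γQ≡P out)
                     (+-monoˡ-≤ (2 * suc p * n) (*-monoʳ-≤ (2 * suc q) (out≤degH x)))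
  ... | inj₂ in′ = ≤-trans (degree-condition-ℕ γ (suc p) (suc q) n (indeg G x) γQ≡P in′)
                     (+-monoˡ-≤ (2 * suc p * n) (*-monoʳ-≤ (2 * suc q) (in≤degH x)))

  edgesIn-toSub : ∀ S → edgesIn G (toSub S) ≡ edgesP S
  edgesIn-toSub S = sumFin-cong n λ x → sumFin-cong n λ y →
    cong 𝟙 (cong₂ (λ a b → a ∧ b ∧ adj G x y) (mem-toSub S x) (mem-toSub S y))

  crossEdges-toSub : ∀ A → crossEdges G (toSub A) ≡ crossP A
  crossEdges-toSub A = sumFin-cong n λ x → sumFin-cong n λ y →
    cong 𝟙 (cong₂ (λ a b → ((a ∧ not b) ∨ (not a ∧ b)) ∧ adj G x y) (mem-toSub A x) (mem-toSub A y))

  conclusion : (γ : ℚ) (p q : ℕ) → γ Q.* ι (suc q) ≡ ι (suc p) → 2 ∣ n → Outcome (suc p) (suc q) (n / 2) →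
    (Σ (Subset n) λ S → IsIndependent (ℕ→ℚ 6 Q.* γ) G S × n / 2 ≤ ∣ S ∣)
    ⊎ IsCloseTo2K (ℕ→ℚ 6 Q.* γ) G
    ⊎ PerfectMatching G
  conclusion γ p q γQ≡P _ (inj₁ (S , few , large)) = inj₁ (toSub S ,
    subst (λ e → ι e Q.≤ ι 6 Q.* γ Q.* ι (n * n)) (sym (edgesIn-toSub S)) (bound-ℚ γ (suc p) q (edgesP S) (n * n) γQ≡P few) ,
    subst (n / 2 ≤_) (sym (size-toSub S)) large)
  conclusion γ p q γQ≡P 2∣n (inj₂ (inj₁ (A , |A| , few))) = inj₂ (inj₁ record
    { A        = toSub A
    ; sizeA    = trans (size-toSub A) |A|
    ; sizeB    = trans |Ā| (sym (trans (+-distrib-/-∣ˡ 1 2∣n) (+-identityʳ (n / 2))))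
    ; fewCross = subst (λ e → ι e Q.≤ ι 6 Q.* γ Q.* ι (n * n)) (sym (crossEdges-toSub A))
                   (bound-ℚ γ (suc p) q (crossP A) (n * n) γQ≡P few) })
    where
    |Ā| : complementSize (toSub A) ≡ n / 2
    |Ā| = trans (sumFin-cong n (λ x → cong (λ b → 𝟙 (not b)) (mem-toSub A x)))
            (+-cancelˡ-≡ (n / 2) _ _ (trans (cong (_+ Σ𝟙 n (λ x → not (A x))) (sym |A|))
                                             (trans (Σ𝟙-compl n A) (halves 2∣n))))
  conclusion γ p q γQ≡P _ (inj₂ (inj₂ pm)) = inj₂ (inj₂ pm)


open import Data.Nat using (_≤_; _*_; _/_; suc)
open import Data.Nat.Divisibility using (_∣_)
open import Data.Rational using (ℚ; 0ℚ; ½; _-_; _<_)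
open import Data.Fin using (Fin)
open import Data.Fin.Subset using (Subset; ∣_∣)
open import Data.Product using (Σ; _×_; _,_)
open import Data.Sum using (_⊎_)

-- Proposition 10.6, for every even n (no lower bound on n is needed): write
-- γ = (1+p)/(1+q), run the algorithm with h = n/2 and translate its outcome.
proposition10p6 :
    (γ : ℚ) → 0ℚ < γ →
    Σ ℕ λ n₀ → (n : ℕ) → n₀ ≤ n → 2 ∣ n →
    (G : Digraph n) →
    ((x : Fin n) →
      ((½ - γ) Data.Rational.* ℕ→ℚ n Data.Rational.≤ ℕ→ℚ (outdeg G x))
      ⊎ ((½ - γ) Data.Rational.* ℕ→ℚ n Data.Rational.≤ ℕ→ℚ (indeg G x))) →
    (Σ (Subset n) λ S → IsIndependent (ℕ→ℚ 6 Data.Rational.* γ) G S × n / 2 ≤ ∣ S ∣)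
    ⊎ IsCloseTo2K (ℕ→ℚ 6 Data.Rational.* γ) G
    ⊎ PerfectMatching G
proposition10p6 γ γ>0 with RationalBridge.positive-fraction γ γ>0
... | p , q , γQ≡P = 0 , λ n _ 2∣n G deg →
  Translation.conclusion G γ p q γQ≡P 2∣n
    (Algorithm.Run.outcome G (suc p) (suc q) (n / 2) (Translation.halves G 2∣n)
      (Translation.degree-large G γ p q γQ≡P deg))
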